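{- Let $G$ be a simple graph on $n$ vertices with $\delta(G)\ge\lfloor n/2\rfloor+1$. Then $\mathrm{sn}(G)=\mathrm{gon}(G)=n-\alpha(G)$.
   Context: $\delta(G)$ is the minimum valence of a vertex, $\alpha(G)$ the independence number. Scramble number $\mathrm{sn}$: a scramble is a finite collection of nonempty vertex sets (eggs) each inducing a connected subgraph; its order is $\min(h,e)$ where $h$ is the minimum size of a vertex set meeting every egg and $e$ is the minimum of $|E(A,A^C)|$ (number of edges between $A$ and $A^C$) over $A\subseteq V$ containing some egg whose complement contains some egg ($+\infty$ if none); $\mathrm{sn}$ is the maximum order. Gonality (of a connected graph): a divisor is an integer combination of vertices; firing a vertex $w$ removes $\mathrm{val}(w)$ chips from $w$ and gives each other vertex one chip per edge to $w$; divisors are equivalent if related by firings; $D$ has positive rank if $D-(v)$ is equivalent to an effective divisor for every vertex $v$; $\mathrm{gon}$ is the minimum degree of a positive rank divisor. -}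

module Defs where

open import Data.Bool using (Bool; true; false; if_then_else_; _∧_; not)
open import Data.Nat as ℕ using (ℕ; _≤_; _⊓_)
open import Data.Integer as ℤ using (ℤ; +_)
open import Data.Fin using (Fin; _≟_)
open import Data.Fin.Subset using (Subset; _∈_; _∉_; _⊆_; ∁; ∣_∣; Nonempty)
open import Data.List using (List; map; foldr; allFin)
open import Data.List.Relation.Unary.All using (All)
import Data.List.Membership.Propositional
import Data.Fin.Subset.Properties
open import Data.Product using (Σ; ∃; _×_; _,_)
open import Data.Sum using (_⊎_)
open import Relation.Nullary using (¬_; does)
open import Relation.Binary.PropositionalEquality using (_≡_)
open import Relation.Binary.Construct.Closure.Equivalence using (EqClosure)

record Graph (n : ℕ) : Set where
  field
    adj        : Fin n → Fin n → Bool
    adj-sym    : ∀ u v → adj u v ≡ adj v u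
    adj-irrefl : ∀ v → adj v v ≡ false
open Graph public

sumℕ : ∀ {n} → (Fin n → ℕ) → ℕ
sumℕ {n} f = foldr ℕ._+_ 0 (map f (allFin n))

sumℤ : ∀ {n} → (Fin n → ℤ) → ℤ
sumℤ {n} f = foldr ℤ._+_ (+ 0) (map f (allFin n))

bool→ℕ : Bool → ℕ
bool→ℕ true  = 1
bool→ℕ false = 0

val : ∀ {n} → Graph n → Fin n → ℕ
val G v = sumℕ (λ u → bool→ℕ (adj G v u))

Independent : ∀ {n} → Graph n → Subset n → Set
Independent G I = ∀ u v → u ∈ I → v ∈ I → adj G u v ≡ false

IsIndependenceNumber : ∀ {n} → Graph n → ℕ → Set
IsIndependenceNumber G a =
  (∃ λ I → Independent G I × ∣ I ∣ ≡ a) ×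
  (∀ I → Independent G I → ∣ I ∣ ≤ a)

data WalkIn {n} (G : Graph n) (E : Subset n) : Fin n → Fin n → Set where
  stop : ∀ {u} → u ∈ E → WalkIn G E u u
  step : ∀ {u w v} → u ∈ E → adj G u w ≡ true → WalkIn G E w v → WalkIn G E u v

InducesConnected : ∀ {n} → Graph n → Subset n → Set
InducesConnected G E = ∀ u v → u ∈ E → v ∈ E → WalkIn G E u v

IsEgg : ∀ {n} → Graph n → Subset n → Set
IsEgg G E = Nonempty E × InducesConnected G E

Scramble : ∀ {n} → Graph n → Set
Scramble {n} G = Σ (List (Subset n)) (All (IsEgg G))

eggs : ∀ {n} {G : Graph n} → Scramble G → List (Subset n)
eggs (S , _) = S

Hitting : ∀ {n} {G : Graph n} → Scramble G → Subset n → Set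
Hitting S H = All (λ E → ∃ λ v → v ∈ H × v ∈ E) (eggs S)

IsHittingNumber : ∀ {n} {G : Graph n} → Scramble G → ℕ → Set
IsHittingNumber S h =
  (∃ λ H → Hitting S H × ∣ H ∣ ≡ h) ×
  (∀ H → Hitting S H → h ≤ ∣ H ∣)

cutSize : ∀ {n} → Graph n → Subset n → ℕ
cutSize G A =
  sumℕ (λ u → sumℕ (λ v →
    bool→ℕ (does (Data.Fin.Subset.Properties._∈?_ u A) ∧ not (does (Data.Fin.Subset.Properties._∈?_ v A)) ∧ adj G u v)))

Separating : ∀ {n} {G : Graph n} → Scramble G → Subset n → Set
Separating S A =
  (∃ λ E → Data.List.Membership.Propositional._∈_ E (eggs S) × E ⊆ A) ×
  (∃ λ E → Data.List.Membership.Propositional._∈_ E (eggs S) × E ⊆ ∁ A)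

IsEggCutNumber : ∀ {n} {G : Graph n} → Scramble G → ℕ → Set
IsEggCutNumber {G = G} S e =
  (∃ λ A → Separating S A × cutSize G A ≡ e) ×
  (∀ A → Separating S A → e ≤ cutSize G A)

-- k is the order min(h, e) of S  (e = +∞ when no separating set exists)
IsOrder : ∀ {n} {G : Graph n} → Scramble G → ℕ → Set
IsOrder S k = ∃ λ h → IsHittingNumber S h ×
  (((∀ A → ¬ Separating S A) × k ≡ h) ⊎
   (∃ λ e → IsEggCutNumber S e × k ≡ h ⊓ e))

IsScrambleNumber : ∀ {n} → Graph n → ℕ → Set
IsScrambleNumber G k =
  (∃ λ (S : Scramble G) → IsOrder S k) ×
  (∀ (S : Scramble G) m → IsOrder S m → m ≤ k)

Divisor : ℕ → Set
Divisor n = Fin n → ℤ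

deg : ∀ {n} → Divisor n → ℤ
deg D = sumℤ D

fire : ∀ {n} → Graph n → Fin n → Divisor n → Divisor n
fire G w D v =
  if does (v ≟ w) then D v ℤ.- (+ val G w) else D v ℤ.+ (+ bool→ℕ (adj G w v))

FiringStep : ∀ {n} → Graph n → Divisor n → Divisor n → Set
FiringStep G D D′ = ∃ λ w → ∀ v → D′ v ≡ fire G w D v

_∼[_]_ : ∀ {n} → Divisor n → Graph n → Divisor n → Set
D ∼[ G ] D′ = EqClosure (FiringStep G) D D′

Effective : ∀ {n} → Divisor n → Set
Effective D = ∀ v → + 0 ℤ.≤ D v

minusPoint : ∀ {n} → Divisor n → Fin n → Divisor n
minusPoint D v u = if does (u ≟ v) then D u ℤ.- + 1 else D u

PositiveRank : ∀ {n} → Graph n → Divisor n → Set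
PositiveRank G D = ∀ v → ∃ λ E → minusPoint D v ∼[ G ] E × Effective E

IsGonality : ∀ {n} → Graph n → ℕ → Set
IsGonality G k =
  (∃ λ D → PositiveRank G D × deg D ≡ + k) ×
  (∀ D → PositiveRank G D → + k ℤ.≤ deg D)

-- Let I be a maximum independent set. One chip on every vertex outside I is a divisor of positive
-- rank: a vertex of I can take a chip from each of its neighbours, all outside I, by firing backwards.
-- A scramble is either hit by the complement of I or has an egg inside I, which, being connected, is a
-- single vertex v; then either every egg contains v or {v} is separating with cut val v ≤ n − α.
-- Conversely the edges form a scramble whose hitting sets are the vertex covers, and a separating set
-- has two vertices on each side, so its cut is at least n − 1 ≥ n − α once every valence exceeds n/2.
--
-- For gonality, let c be effective of positive rank with fewer than n − α chips. Call a vertex heavy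
-- if it holds at least its valence in chips, and good if it holds no chip and has no heavy neighbour.
-- Charging every other vertex to a chip shows that more than α vertices are good or heavy, so two of
-- them are adjacent. Two heavy vertices would need more than n chips and a good vertex has no heavy
-- neighbour, so both are good. In a firing script moving a chip onto one of them, the cut of every
-- upper level set is paid for by chips, so it is below n − 1; this makes every good vertex with a
-- higher neighbour the strict minimum of the script, which the two adjacent good vertices cannot both be.

module Submission where

open import Defs
open import Data.Nat using (ℕ; _+_; _∸_; _/_; _≤_)
open import Data.Fin using (Fin)
open import Data.Product using (_×_)

import Algebra.Properties.Semiring.Sum
open import Data.Bool using (Bool; true; false; _∧_; _∨_; not; if_then_else_)
import Data.Bool.Properties as BoolP
open import Data.Empty using (⊥; ⊥-elim)
open import Data.Fin as Fin using (zero; suc; _≟_)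
import Data.Fin.Properties as FinP
open import Data.Fin.Subset using (Subset; _∈_; _∉_; _⊆_; ∁; ⁅_⁆; _∪_; ∣_∣; inside; outside)
import Data.Fin.Subset.Properties as SubsetP
open import Data.Integer as ℤ using (ℤ; +_; -[1+_])
import Data.Integer.Properties as ℤP
open import Data.Integer.Tactic.RingSolver using (solve-∀)
open import Data.List as List using (List)
open import Data.List.Membership.Propositional using (find; lose) renaming (_∈_ to _∈ₗ_)
import Data.List.Membership.Propositional.Properties as ∈ₗP
import Data.List.Relation.Unary.Any as Any
open import Data.List.Relation.Unary.All as All using (All)
import Data.List.Relation.Unary.All.Properties as AllP
open import Data.Nat as ℕ using (zero; suc; _*_; _<_; z≤n; s≤s)
open import Data.Nat.DivMod using (_%_; m≡m%n+[m/n]*n; m%n<n)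
import Data.Nat.Properties as ℕP
import Data.Nat.Tactic.RingSolver as NatSolver
open import Data.Product using (∃; ∃₂; _,_; proj₁; proj₂; uncurry)
open import Data.Sum using (_⊎_; inj₁; inj₂)
open import Data.Vec as Vec using ([]; _∷_)
import Data.Vec.Functional as Vector
import Data.Vec.Properties as VecP
open import Function using (_∘_; id)
open import Relation.Binary.Construct.Closure.ReflexiveTransitive using (ε; _◅_)
open import Relation.Binary.Construct.Closure.Symmetric using (fwd; bwd)
open import Relation.Binary.PropositionalEquality
  using (_≡_; _≢_; refl; sym; trans; cong; cong₂; subst; subst₂; module ≡-Reasoning)
open import Relation.Nullary using (¬_; Dec; yes; no; does; _×-dec_)
import Relation.Nullary.Decidable as Dec
open import Relation.Nullary.Decidable using (dec-true; dec-false)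

module ℕΣ = Algebra.Properties.Semiring.Sum ℕP.+-*-semiring
module ℤΣ = Algebra.Properties.Semiring.Sum ℤP.+-*-semiring
open ℕΣ using () renaming (sum to Σℕ)
open ℤΣ using () renaming (sum to Σℤ)

foldr-map-tabulate : ∀ {A B : Set} (_∙_ : B → B → B) (e : B) (f : A → B) {m} (g : Fin m → A) →
  List.foldr _∙_ e (List.map f (List.tabulate g)) ≡ Vector.foldr _∙_ e (f ∘ g)
foldr-map-tabulate _∙_ e f {zero} g = refl
foldr-map-tabulate _∙_ e f {suc m} g = cong (f (g zero) ∙_) (foldr-map-tabulate _∙_ e f (g ∘ suc))

sumℕ≡Σℕ : ∀ {n} (f : Fin n → ℕ) → sumℕ f ≡ Σℕ f
sumℕ≡Σℕ f = foldr-map-tabulate _+_ 0 f id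

sumℤ≡Σℤ : ∀ {n} (f : Fin n → ℤ) → sumℤ f ≡ Σℤ f
sumℤ≡Σℤ f = foldr-map-tabulate ℤ._+_ (+ 0) f id

Σℕ-mono-≤ : ∀ {n} {f g : Fin n → ℕ} → (∀ i → f i ≤ g i) → Σℕ f ≤ Σℕ g
Σℕ-mono-≤ {zero} f≤g = z≤n
Σℕ-mono-≤ {suc n} f≤g = ℕP.+-mono-≤ (f≤g zero) (Σℕ-mono-≤ (f≤g ∘ suc))

term≤Σℕ : ∀ {n} (f : Fin n → ℕ) i → f i ≤ Σℕ f
term≤Σℕ f zero = ℕP.m≤m+n _ _
term≤Σℕ f (suc i) = ℕP.≤-trans (term≤Σℕ (f ∘ suc) i) (ℕP.m≤n+m _ _)

two-terms≤Σℕ : ∀ {n} (f : Fin n → ℕ) {i j} → i ≢ j → f i + f j ≤ Σℕ f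
two-terms≤Σℕ f {zero} {zero} i≢j = ⊥-elim (i≢j refl)
two-terms≤Σℕ f {zero} {suc j} _ = ℕP.+-monoʳ-≤ (f zero) (term≤Σℕ (f ∘ suc) j)
two-terms≤Σℕ f {suc i} {zero} _ =
  ℕP.≤-trans (ℕP.≤-reflexive (ℕP.+-comm (f (suc i)) (f zero))) (ℕP.+-monoʳ-≤ (f zero) (term≤Σℕ (f ∘ suc) i))
two-terms≤Σℕ f {suc i} {suc j} i≢j =
  ℕP.≤-trans (two-terms≤Σℕ (f ∘ suc) (i≢j ∘ cong suc)) (ℕP.m≤n+m _ _)

Σℤ-mono-≤ : ∀ {n} {f g : Fin n → ℤ} → (∀ i → f i ℤ.≤ g i) → Σℤ f ℤ.≤ Σℤ g
Σℤ-mono-≤ {zero} f≤g = ℤP.≤-refl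
Σℤ-mono-≤ {suc n} f≤g = ℤP.+-mono-≤ (f≤g zero) (Σℤ-mono-≤ (f≤g ∘ suc))

Σℤ-pos : ∀ {n} (f : Fin n → ℕ) → Σℤ (λ i → + f i) ≡ + Σℕ f
Σℤ-pos {zero} f = refl
Σℤ-pos {suc n} f = trans (cong (ℤ._+_ (+ f zero)) (Σℤ-pos (f ∘ suc))) (sym (ℤP.pos-+ (f zero) (Σℕ (f ∘ suc))))

Σℤ-neg : ∀ {n} (f : Fin n → ℤ) → Σℤ (λ i → ℤ.- f i) ≡ ℤ.- Σℤ f
Σℤ-neg {zero} f = refl
Σℤ-neg {suc n} f = trans (cong (ℤ._+_ (ℤ.- f zero)) (Σℤ-neg (f ∘ suc))) (sym (ℤP.neg-distrib-+ (f zero) (Σℤ (f ∘ suc))))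

Σℤ-antisymmetric : ∀ {n} (k : Fin n → Fin n → ℤ) → (∀ i j → k j i ≡ ℤ.- k i j) →
  Σℤ (λ i → Σℤ (k i)) ≡ + 0
Σℤ-antisymmetric k anti = x≡-x⇒x≡0 (begin
  Σℤ (λ i → Σℤ (λ j → k i j))          ≡⟨ ℤΣ.∑-comm k ⟩
  Σℤ (λ j → Σℤ (λ i → k i j))          ≡⟨ ℤΣ.sum-cong-≗ (λ j → ℤΣ.sum-cong-≗ (λ i → anti j i)) ⟩
  Σℤ (λ j → Σℤ (λ i → ℤ.- k j i))      ≡⟨ ℤΣ.sum-cong-≗ (λ j → Σℤ-neg (k j)) ⟩
  Σℤ (λ j → ℤ.- Σℤ (k j))              ≡⟨ Σℤ-neg (λ j → Σℤ (k j)) ⟩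
  ℤ.- Σℤ (λ i → Σℤ (λ j → k i j))      ∎)
  where
  open ≡-Reasoning
  x≡-x⇒x≡0 : ∀ {x} → x ≡ ℤ.- x → x ≡ + 0
  x≡-x⇒x≡0 {+ zero} _ = refl
  x≡-x⇒x≡0 {+ suc _} ()
  x≡-x⇒x≡0 { -[1+ _ ]} ()

i<j⇒1≤j-i : ∀ {i j} → i ℤ.< j → + 1 ℤ.≤ j ℤ.- i
i<j⇒1≤j-i {i} {j} i<j = subst (ℤ._≤ j ℤ.- i) (cancel i) (ℤP.+-monoˡ-≤ (ℤ.- i) (ℤP.i<j⇒suc[i]≤j i<j))
  where
  cancel : ∀ i → + 1 ℤ.+ i ℤ.- i ≡ + 1
  cancel = solve-∀

true⇒witness : ∀ {A : Set} (a? : Dec A) → does a? ≡ true → A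
true⇒witness (yes a) _ = a

false⇒¬witness : ∀ {A : Set} (a? : Dec A) → does a? ≡ false → ¬ A
false⇒¬witness (no ¬a) _ = ¬a

∨≡true⇒⊎ : ∀ {b b′} → b ∨ b′ ≡ true → b ≡ true ⊎ b′ ≡ true
∨≡true⇒⊎ {true} _ = inj₁ refl
∨≡true⇒⊎ {false} b′ = inj₂ b′

indicator : ∀ {n} → Fin n → Fin n → ℕ
indicator w u = bool→ℕ (does (u ≟ w))

indicator-self : ∀ {n} (w : Fin n) → indicator w w ≡ 1
indicator-self w = cong bool→ℕ (dec-true (w ≟ w) refl)

indicator-other : ∀ {n} {w u : Fin n} → u ≢ w → indicator w u ≡ 0
indicator-other {w = w} {u} u≢w = cong bool→ℕ (dec-false (u ≟ w) u≢w)

Σℤ-indicator : ∀ {n} (w : Fin n) (f : Fin n → ℤ) → Σℤ (λ u → + indicator w u ℤ.* f u) ≡ f w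
Σℤ-indicator {suc n} zero f = begin
  + 1 ℤ.* f zero ℤ.+ Σℤ (λ u → + 0 ℤ.* f (suc u))
    ≡⟨ cong₂ ℤ._+_ (ℤP.*-identityˡ (f zero)) (ℤΣ.sum-cong-≗ (λ u → ℤP.*-zeroˡ (f (suc u)))) ⟩
  f zero ℤ.+ Σℤ {n} (λ _ → + 0)
    ≡⟨ cong (ℤ._+_ (f zero)) (ℤΣ.sum-replicate-zero n) ⟩
  f zero ℤ.+ + 0
    ≡⟨ ℤP.+-identityʳ (f zero) ⟩
  f zero ∎
  where open ≡-Reasoning
Σℤ-indicator {suc n} (suc w) f =
  trans (cong₂ ℤ._+_ (ℤP.*-zeroˡ (f zero)) (Σℤ-indicator w (f ∘ suc))) (ℤP.+-identityˡ (f (suc w)))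

count : ∀ {n} → (Fin n → Bool) → ℕ
count P = Σℕ (bool→ℕ ∘ P)

count+count-not : ∀ {n} (P : Fin n → Bool) → count P + count (not ∘ P) ≡ n
count+count-not {zero} P = refl
count+count-not {suc n} P with P zero
... | true = cong suc (count+count-not (P ∘ suc))
... | false = trans (ℕP.+-suc (count (P ∘ suc)) _) (cong suc (count+count-not (P ∘ suc)))

2≤count : ∀ {n} (P : Fin n → Bool) {i j} → i ≢ j → P i ≡ true → P j ≡ true → 2 ≤ count P
2≤count P {i} {j} i≢j Pi Pj =
  subst (_≤ count P) (cong₂ _+_ (cong bool→ℕ Pi) (cong bool→ℕ Pj)) (two-terms≤Σℕ (bool→ℕ ∘ P) i≢j)

infix 7 _∈ᵇ_

_∈ᵇ_ : ∀ {n} → Fin n → Subset n → Bool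
u ∈ᵇ A = does (u SubsetP.∈? A)

∈ᵇ⇒∈ : ∀ {n} {A : Subset n} {u} → u ∈ᵇ A ≡ true → u ∈ A
∈ᵇ⇒∈ = true⇒witness (_ SubsetP.∈? _)

∣p∣≡count-∈ᵇ : ∀ {n} (p : Subset n) → ∣ p ∣ ≡ count (_∈ᵇ p)
∣p∣≡count-∈ᵇ [] = refl
∣p∣≡count-∈ᵇ (inside ∷ p) = cong suc (∣p∣≡count-∈ᵇ p)
∣p∣≡count-∈ᵇ (outside ∷ p) = ∣p∣≡count-∈ᵇ p

∈ᵇ-tabulate : ∀ {n} (P : Fin n → Bool) u → u ∈ᵇ Vec.tabulate P ≡ P u
∈ᵇ-tabulate P u = trans (∈ᵇ≡lookup (Vec.tabulate P) u) (VecP.lookup∘tabulate P u)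
  where
  ∈ᵇ≡lookup : ∀ {n} (p : Subset n) u → u ∈ᵇ p ≡ Vec.lookup p u
  ∈ᵇ≡lookup (inside ∷ p) zero = refl
  ∈ᵇ≡lookup (outside ∷ p) zero = refl
  ∈ᵇ≡lookup (_ ∷ p) (suc u) = ∈ᵇ≡lookup p u

x∈p⇒1≤∣p∣ : ∀ {n} {p : Subset n} {x} → x ∈ p → 1 ≤ ∣ p ∣
x∈p⇒1≤∣p∣ {x = x} x∈p = subst (_≤ _) (SubsetP.∣⁅x⁆∣≡1 x)
  (SubsetP.p⊆q⇒∣p∣≤∣q∣ λ y∈⁅x⁆ → subst (_∈ _) (sym (SubsetP.x∈⁅y⁆⇒x≡y x y∈⁅x⁆)) x∈p)

∣tabulate∣≡count : ∀ {n} (P : Fin n → Bool) → ∣ Vec.tabulate P ∣ ≡ count P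
∣tabulate∣≡count P = trans (∣p∣≡count-∈ᵇ (Vec.tabulate P)) (ℕΣ.sum-cong-≗ (cong bool→ℕ ∘ ∈ᵇ-tabulate P))

adjacent⇒≢ : ∀ {n} (G : Graph n) {u v} → adj G u v ≡ true → u ≢ v
adjacent⇒≢ G {u} uv refl with () ← trans (sym uv) (adj-irrefl G u)

val≡Σℕ : ∀ {n} (G : Graph n) w → val G w ≡ Σℕ (λ u → bool→ℕ (adj G w u))
val≡Σℕ G w = sumℕ≡Σℕ (λ u → bool→ℕ (adj G w u))

1≤val⇒neighbour : ∀ {n} (G : Graph n) {v} → 1 ≤ val G v → ∃ λ u → adj G v u ≡ true
1≤val⇒neighbour {n} G {v} 1≤val with FinP.any? (λ u → adj G v u BoolP.≟ true)
... | yes neighbour = neighbour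
... | no ∄neighbour = ⊥-elim (ℕP.<⇒≱ 1≤val (begin
  val G v                          ≡⟨ val≡Σℕ G v ⟩
  Σℕ (λ u → bool→ℕ (adj G v u))    ≡⟨ ℕΣ.sum-cong-≗ no-edge ⟩
  Σℕ {n} (λ _ → 0)                 ≡⟨ ℕΣ.sum-replicate-zero n ⟩
  0                                ∎))
  where
  open ℕP.≤-Reasoning
  no-edge : ∀ u → bool→ℕ (adj G v u) ≡ 0
  no-edge u with adj G v u in vu
  ... | false = refl
  ... | true = ⊥-elim (∄neighbour (u , vu))

module _ {n} (G : Graph n) where

  neighboursIn : (Fin n → Bool) → Fin n → ℕ
  neighboursIn S u = Σℕ λ v → bool→ℕ (S v ∧ adj G u v)

  cut : (Fin n → Bool) → ℕ
  cut S = Σℕ λ u → Σℕ λ v → bool→ℕ (S u ∧ not (S v) ∧ adj G u v)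

  cutSize≡cut : ∀ A → cutSize G A ≡ cut (_∈ᵇ A)
  cutSize≡cut A = trans (sumℕ≡Σℕ λ u → sumℕ (edge u)) (ℕΣ.sum-cong-≗ (sumℕ≡Σℕ ∘ edge))
    where
    edge : Fin n → Fin n → ℕ
    edge u v = bool→ℕ (u ∈ᵇ A ∧ not (v ∈ᵇ A) ∧ adj G u v)

  cut-not : ∀ S → cut S ≡ cut (not ∘ S)
  cut-not S = trans (ℕΣ.∑-comm (λ u v → bool→ℕ (S u ∧ not (S v) ∧ adj G u v)))
                    (ℕΣ.sum-cong-≗ λ v → ℕΣ.sum-cong-≗ λ u → edge-reversed u v)
    where
    edge-reversed : ∀ u v → bool→ℕ (S u ∧ not (S v) ∧ adj G u v) ≡ bool→ℕ (not (S v) ∧ not (not (S u)) ∧ adj G v u)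
    edge-reversed u v rewrite adj-sym G u v with S u | S v
    ... | true  | true  = refl
    ... | true  | false = refl
    ... | false | true  = refl
    ... | false | false = refl

  neighboursIn+neighboursIn-not : ∀ S u → neighboursIn S u + neighboursIn (not ∘ S) u ≡ val G u
  neighboursIn+neighboursIn-not S u = begin
    neighboursIn S u + neighboursIn (not ∘ S) u
      ≡⟨ ℕΣ.∑-distrib-+ (λ v → bool→ℕ (S v ∧ adj G u v)) (λ v → bool→ℕ (not (S v) ∧ adj G u v)) ⟨
    Σℕ (λ v → bool→ℕ (S v ∧ adj G u v) + bool→ℕ (not (S v) ∧ adj G u v))
      ≡⟨ ℕΣ.sum-cong-≗ split ⟩
    Σℕ (λ v → bool→ℕ (adj G u v))
      ≡⟨ val≡Σℕ G u ⟨
    val G u ∎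
    where
    open ≡-Reasoning
    split : ∀ v → bool→ℕ (S v ∧ adj G u v) + bool→ℕ (not (S v) ∧ adj G u v) ≡ bool→ℕ (adj G u v)
    split v with S v | adj G u v
    ... | true  | true  = refl
    ... | true  | false = refl
    ... | false | _     = refl

  neighboursIn<count : ∀ S u → S u ≡ true → neighboursIn S u < count S
  neighboursIn<count S u Su = begin-strict
    neighboursIn S u
      <⟨ ℕP.m<m+n _ (ℕP.≤-trans (ℕP.≤-reflexive (sym (indicator-self u))) (term≤Σℕ (indicator u) u)) ⟩
    neighboursIn S u + Σℕ (indicator u)
      ≡⟨ ℕΣ.∑-distrib-+ (λ v → bool→ℕ (S v ∧ adj G u v)) (indicator u) ⟨
    Σℕ (λ v → bool→ℕ (S v ∧ adj G u v) + indicator u v)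
      ≤⟨ Σℕ-mono-≤ pointwise ⟩
    count S ∎
    where
    open ℕP.≤-Reasoning
    pointwise : ∀ v → bool→ℕ (S v ∧ adj G u v) + indicator u v ≤ bool→ℕ (S v)
    pointwise v with v ≟ u
    ... | yes refl rewrite Su | adj-irrefl G v = ℕP.≤-refl
    ... | no _ with S v | adj G u v
    ... | true  | true  = ℕP.≤-refl
    ... | true  | false = z≤n
    ... | false | _     = ℕP.≤-refl

  cut≡Σ-neighboursOut : ∀ S → cut S ≡ Σℕ (λ u → bool→ℕ (S u) * neighboursIn (not ∘ S) u)
  cut≡Σ-neighboursOut S = ℕΣ.sum-cong-≗ λ u →
    trans (ℕΣ.sum-cong-≗ (λ v → bool→ℕ-∧ (S u) (not (S v) ∧ adj G u v)))
          (sym (ℕΣ.*-distribˡ-sum (bool→ℕ (S u)) (λ v → bool→ℕ (not (S v) ∧ adj G u v))))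
    where
    bool→ℕ-∧ : ∀ b c → bool→ℕ (b ∧ c) ≡ bool→ℕ b * bool→ℕ c
    bool→ℕ-∧ true  c = sym (ℕP.+-identityʳ _)
    bool→ℕ-∧ false c = refl

  -- each vertex of S has at most |S| − 1 neighbours inside S
  count*deficit≤cut : ∀ d → (∀ v → d ≤ val G v) → ∀ S → count S * (d ∸ (count S ∸ 1)) ≤ cut S
  count*deficit≤cut d δ S = begin
    count S * k                              ≡⟨ ℕP.*-comm (count S) k ⟩
    k * count S                              ≡⟨ ℕΣ.*-distribˡ-sum k (bool→ℕ ∘ S) ⟩
    Σℕ (λ u → k * bool→ℕ (S u))               ≤⟨ Σℕ-mono-≤ pointwise ⟩
    Σℕ (λ u → bool→ℕ (S u) * neighboursIn (not ∘ S) u) ≡⟨ cut≡Σ-neighboursOut S ⟨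
    cut S                                    ∎
    where
    open ℕP.≤-Reasoning
    k = d ∸ (count S ∸ 1)
    pointwise : ∀ u → k * bool→ℕ (S u) ≤ bool→ℕ (S u) * neighboursIn (not ∘ S) u
    pointwise u with S u in Su
    ... | false = ℕP.≤-reflexive (ℕP.*-zeroʳ k)
    ... | true = begin
      k * 1                                            ≡⟨ ℕP.*-identityʳ k ⟩
      d ∸ (count S ∸ 1)                                ≤⟨ ℕP.∸-mono (δ u) (ℕP.∸-monoˡ-≤ 1 (neighboursIn<count S u Su)) ⟩
      val G u ∸ neighboursIn S u                       ≡⟨ cong (_∸ neighboursIn S u) (neighboursIn+neighboursIn-not S u) ⟨
      neighboursIn S u + neighboursIn (not ∘ S) u ∸ neighboursIn S u ≡⟨ ℕP.m+n∸m≡n (neighboursIn S u) _ ⟩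
      neighboursIn (not ∘ S) u                         ≡⟨ ℕP.+-identityʳ _ ⟨
      1 * neighboursIn (not ∘ S) u                     ∎

  cut≤count*count : ∀ S T → (∀ {u w} → S u ≡ true → S w ≡ false → adj G u w ≡ true → T w ≡ true) →
    cut S ≤ count S * count T
  cut≤count*count S T exits-into-T = begin
    cut S
      ≤⟨ Σℕ-mono-≤ (λ u → Σℕ-mono-≤ (pointwise u)) ⟩
    Σℕ (λ u → Σℕ λ w → bool→ℕ (S u) * bool→ℕ (T w))
      ≡⟨ ℕΣ.sum-cong-≗ (λ u → ℕΣ.*-distribˡ-sum (bool→ℕ (S u)) (bool→ℕ ∘ T)) ⟨
    Σℕ (λ u → bool→ℕ (S u) * count T)
      ≡⟨ ℕΣ.*-distribʳ-sum (count T) (bool→ℕ ∘ S) ⟨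
    count S * count T ∎
    where
    open ℕP.≤-Reasoning
    pointwise : ∀ u w → bool→ℕ (S u ∧ not (S w) ∧ adj G u w) ≤ bool→ℕ (S u) * bool→ℕ (T w)
    pointwise u w with S u in Su | S w in Sw | adj G u w in uw
    ... | false | _     | _     = z≤n
    ... | true  | true  | _     = z≤n
    ... | true  | false | false = z≤n
    ... | true  | false | true  rewrite exits-into-T Su Sw uw = ℕP.≤-refl

n≤2[n/2]+1 : ∀ n → n ≤ 2 * (n / 2) + 1
n≤2[n/2]+1 n = begin
  n                      ≡⟨ m≡m%n+[m/n]*n n 2 ⟩
  n % 2 + n / 2 * 2      ≤⟨ ℕP.+-mono-≤ (ℕP.≤-pred (m%n<n n 2)) (ℕP.≤-reflexive (ℕP.*-comm (n / 2) 2)) ⟩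
  1 + 2 * (n / 2)        ≡⟨ ℕP.+-comm 1 _ ⟩
  2 * (n / 2) + 1        ∎
  where open ℕP.≤-Reasoning

2m≤k*[m+1∸[k∸1]] : ∀ m k → 2 ≤ k → k ≤ m → 2 * m ≤ k * ((m + 1) ∸ (k ∸ 1))
2m≤k*[m+1∸[k∸1]] m (suc (suc i)) (s≤s (s≤s _)) k≤m with j , refl ← ℕP.m≤n⇒∃[o]m+o≡n k≤m = begin
  2 * (2 + i + j)                    ≤⟨ ℕP.m≤m+n _ (i * j) ⟩
  2 * (2 + i + j) + i * j            ≡⟨ expand i j ⟩
  (2 + i) * (2 + j)                  ≡⟨ cong ((2 + i) *_) (ℕP.m+n∸m≡n i (2 + j)) ⟨
  (2 + i) * (i + (2 + j) ∸ i)        ≡⟨ cong (λ t → (2 + i) * (t ∸ i)) (regroup i j) ⟩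
  (2 + i) * ((2 + i + j + 1) ∸ suc i) ∎
  where
  open ℕP.≤-Reasoning
  expand : ∀ i j → 2 * (2 + i + j) + i * j ≡ (2 + i) * (2 + j)
  expand = NatSolver.solve-∀
  regroup : ∀ i j → i + (2 + j) ≡ suc (i + j + 1)
  regroup = NatSolver.solve-∀

module _ {n} (G : Graph n) (δ : ∀ v → n / 2 + 1 ≤ val G v) where

  n∸1≤cut-of-small : ∀ S → 2 ≤ count S → count S ≤ n / 2 → n ∸ 1 ≤ cut G S
  n∸1≤cut-of-small S 2≤∣S∣ ∣S∣≤n/2 = begin
    n ∸ 1                                           ≤⟨ ℕP.∸-monoˡ-≤ 1 (n≤2[n/2]+1 n) ⟩
    2 * (n / 2) + 1 ∸ 1                             ≡⟨ ℕP.m+n∸n≡m _ 1 ⟩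
    2 * (n / 2)                                     ≤⟨ 2m≤k*[m+1∸[k∸1]] (n / 2) (count S) 2≤∣S∣ ∣S∣≤n/2 ⟩
    count S * ((n / 2 + 1) ∸ (count S ∸ 1))         ≤⟨ count*deficit≤cut G (n / 2 + 1) δ S ⟩
    cut G S                                         ∎
    where open ℕP.≤-Reasoning

  n∸1≤cut : ∀ S → 2 ≤ count S → 2 ≤ count (not ∘ S) → n ∸ 1 ≤ cut G S
  n∸1≤cut S 2≤∣S∣ 2≤∣∁S∣ with count S ℕ.≤? n / 2
  ... | yes ∣S∣≤n/2 = n∸1≤cut-of-small S 2≤∣S∣ ∣S∣≤n/2
  ... | no ∣S∣≰n/2 = subst (n ∸ 1 ≤_) (sym (cut-not G S)) (n∸1≤cut-of-small (not ∘ S) 2≤∣∁S∣ ∣∁S∣≤n/2)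
    where
    ∣∁S∣≤n/2 : count (not ∘ S) ≤ n / 2
    ∣∁S∣≤n/2 = ℕP.+-cancelˡ-≤ (suc (n / 2)) _ _ (begin
      suc (n / 2) + count (not ∘ S)   ≤⟨ ℕP.+-monoˡ-≤ _ (ℕP.≰⇒> ∣S∣≰n/2) ⟩
      count S + count (not ∘ S)       ≡⟨ count+count-not S ⟩
      n                               ≤⟨ n≤2[n/2]+1 n ⟩
      2 * (n / 2) + 1                 ≡⟨ regroup (n / 2) ⟩
      suc (n / 2) + n / 2             ∎)
      where
      open ℕP.≤-Reasoning
      regroup : ∀ m → 2 * m + 1 ≡ suc m + m
      regroup = NatSolver.solve-∀

  n<val+val : ∀ u v → n < val G u + val G v
  n<val+val u v = begin-strict
    n                              ≤⟨ n≤2[n/2]+1 n ⟩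
    2 * (n / 2) + 1                <⟨ ℕP.n<1+n _ ⟩
    suc (2 * (n / 2) + 1)          ≡⟨ regroup (n / 2) ⟩
    (n / 2 + 1) + (n / 2 + 1)      ≤⟨ ℕP.+-mono-≤ (δ u) (δ v) ⟩
    val G u + val G v              ∎
    where
    open ℕP.≤-Reasoning
    regroup : ∀ m → suc (2 * m + 1) ≡ (m + 1) + (m + 1)
    regroup = NatSolver.solve-∀

neighbour∉independent : ∀ {n} (G : Graph n) {I} → Independent G I → ∀ {u v} → u ∈ I → adj G u v ≡ true → v ∉ I
neighbour∉independent G I-independent u∈I uv v∈I with () ← trans (sym uv) (I-independent _ _ u∈I v∈I)

module _ {n} (G : Graph n) {a} (α : IsIndependenceNumber G a) where

  count>α⇒edge : ∀ P → a < count P → ∃₂ λ u v → P u ≡ true × P v ≡ true × adj G u v ≡ true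
  count>α⇒edge P a<∣P∣
    with FinP.any? (λ u → FinP.any? λ v → (P u BoolP.≟ true) ×-dec (P v BoolP.≟ true) ×-dec (adj G u v BoolP.≟ true))
  ... | yes (u , v , Pu , Pv , uv) = u , v , Pu , Pv , uv
  ... | no ∄edge = ⊥-elim (ℕP.<⇒≱ a<∣P∣ (subst (_≤ a) (∣tabulate∣≡count P) (proj₂ α (Vec.tabulate P) independent)))
    where
    independent : Independent G (Vec.tabulate P)
    independent u v u∈P v∈P with adj G u v in uv
    ... | false = refl
    ... | true = ⊥-elim (∄edge (u , v , inP u∈P , inP v∈P , uv))
      where
      inP : ∀ {w} → w ∈ Vec.tabulate P → P w ≡ true
      inP {w} w∈P = trans (sym (∈ᵇ-tabulate P w)) (dec-true (w SubsetP.∈? _) w∈P)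

  1≤α : Fin n → 1 ≤ a
  1≤α v = subst (_≤ a) (SubsetP.∣⁅x⁆∣≡1 v) (proj₂ α ⁅ v ⁆ singleton-independent)
    where
    singleton-independent : Independent G ⁅ v ⁆
    singleton-independent u w u∈ w∈
      rewrite SubsetP.x∈⁅y⁆⇒x≡y v u∈ | SubsetP.x∈⁅y⁆⇒x≡y v w∈ = adj-irrefl G v

  ∣∁maximumIndependent∣≡n∸α : ∣ ∁ (proj₁ (proj₁ α)) ∣ ≡ n ∸ a
  ∣∁maximumIndependent∣≡n∸α = trans (SubsetP.∣∁p∣≡n∸∣p∣ (proj₁ (proj₁ α)))
                                   (cong (n ∸_) (proj₂ (proj₂ (proj₁ α))))

  n∸α≤∣H∣ : ∀ H → Independent G (∁ H) → n ∸ a ≤ ∣ H ∣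
  n∸α≤∣H∣ H ∁H-independent = ℕP.m≤n+o⇒m∸n≤o n a (begin
    n                   ≤⟨ ℕP.m≤n+m∸n n ∣ H ∣ ⟩
    ∣ H ∣ + (n ∸ ∣ H ∣)   ≡⟨ cong (_+_ ∣ H ∣) (SubsetP.∣∁p∣≡n∸∣p∣ H) ⟨
    ∣ H ∣ + ∣ ∁ H ∣       ≤⟨ ℕP.+-monoʳ-≤ ∣ H ∣ (proj₂ α (∁ H) ∁H-independent) ⟩
    ∣ H ∣ + a           ≡⟨ ℕP.+-comm ∣ H ∣ a ⟩
    a + ∣ H ∣           ∎)
    where open ℕP.≤-Reasoning

-- A divisor of positive rank and degree n − α

module _ {n} (G : Graph n) where

  unfire : Fin n → Divisor n → Divisor n
  unfire w D u = if does (u ≟ w) then D u ℤ.+ + val G w else D u ℤ.- + bool→ℕ (adj G w u)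

  fire∘unfire : ∀ w D u → fire G w (unfire w D) u ≡ D u
  fire∘unfire w D u with u ≟ w
  ... | yes _ = cancel (D u) (+ val G w)
    where
    cancel : ∀ d k → d ℤ.+ k ℤ.- k ≡ d
    cancel = solve-∀
  ... | no _ = cancel (D u) (+ bool→ℕ (adj G w u))
    where
    cancel : ∀ d k → d ℤ.- k ℤ.+ k ≡ d
    cancel = solve-∀

  outsideDivisor : Subset n → Divisor n
  outsideDivisor I u = + bool→ℕ (u ∈ᵇ ∁ I)

  deg-outsideDivisor : ∀ I → deg (outsideDivisor I) ≡ + (n ∸ ∣ I ∣)
  deg-outsideDivisor I = begin
    deg (outsideDivisor I)                ≡⟨ sumℤ≡Σℤ (outsideDivisor I) ⟩
    Σℤ (outsideDivisor I)                 ≡⟨ Σℤ-pos (λ u → bool→ℕ (u ∈ᵇ ∁ I)) ⟩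
    + count (_∈ᵇ ∁ I)                     ≡⟨ cong +_ (∣p∣≡count-∈ᵇ (∁ I)) ⟨
    + ∣ ∁ I ∣                             ≡⟨ cong +_ (SubsetP.∣∁p∣≡n∸∣p∣ I) ⟩
    + (n ∸ ∣ I ∣)                         ∎
    where open ≡-Reasoning

  outsideDivisor-positiveRank : ∀ I → Independent G I → (∀ v → 1 ≤ val G v) →
    PositiveRank G (outsideDivisor I)
  outsideDivisor-positiveRank I I-independent no-isolated v with v SubsetP.∈? I
  ... | no v∉I = minusPoint (outsideDivisor I) v , ε , effective
    where
    effective : Effective (minusPoint (outsideDivisor I) v)
    effective u with u ≟ v
    ... | yes refl rewrite dec-true (u SubsetP.∈? ∁ I) (SubsetP.x∉p⇒x∈∁p v∉I) = ℤ.+≤+ z≤n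
    ... | no _ = ℤ.+≤+ z≤n
  ... | yes v∈I = E , bwd (v , λ u → sym (fire∘unfire v (minusPoint (outsideDivisor I) v) u)) ◅ ε , effective
    where
    E = unfire v (minusPoint (outsideDivisor I) v)
    effective : Effective E
    effective u with u ≟ v
    ... | yes refl rewrite dec-false (u SubsetP.∈? ∁ I) (SubsetP.x∈p⇒x∉∁p v∈I) = -1+k≥0 (val G u) (no-isolated u)
      where
      -1+k≥0 : ∀ k → 1 ≤ k → + 0 ℤ.≤ (+ 0 ℤ.- + 1) ℤ.+ + k
      -1+k≥0 (suc k) _ = ℤ.+≤+ z≤n
    ... | no _ with adj G v u in vu
    ...   | false = ℤ.+≤+ z≤n
    ...   | true
      rewrite dec-true (u SubsetP.∈? ∁ I) (SubsetP.x∉p⇒x∈∁p (neighbour∉independent G I-independent v∈I vu)) = ℤ.+≤+ z≤n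

-- Bounding the order of a scramble

module _ {A : Set} {P : A → Set} (P? : ∀ x → Dec (P x)) where

  ∃∈? : (xs : List A) → Dec (∃ λ x → x ∈ₗ xs × P x)
  ∃∈? xs = Dec.map′ find (λ (_ , x∈xs , Px) → lose x∈xs Px) (Any.any? P? xs)

  ¬All⇒∃∈¬ : ∀ {xs} → ¬ All P xs → ∃ λ x → x ∈ₗ xs × ¬ P x
  ¬All⇒∃∈¬ = find ∘ AllP.¬All⇒Any¬ P? _

minimal-subset : ∀ {n} (P : Subset n → Set) → (∀ A → Dec (P A)) → (f : Subset n → ℕ) →
  (∀ A → ¬ P A) ⊎ (∃ λ A → P A × ∀ B → P B → f A ≤ f B)
minimal-subset {zero} P P? f with P? []
... | yes p = inj₂ ([] , p , λ { [] _ → ℕP.≤-refl })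
... | no ¬p = inj₁ λ { [] → ¬p }
minimal-subset {suc n} P P? f
  with minimal-subset (P ∘ (inside ∷_)) (P? ∘ (inside ∷_)) (f ∘ (inside ∷_))
     | minimal-subset (P ∘ (outside ∷_)) (P? ∘ (outside ∷_)) (f ∘ (outside ∷_))
... | inj₁ ¬in | inj₁ ¬out = inj₁ λ { (inside ∷ A) → ¬in A ; (outside ∷ A) → ¬out A }
... | inj₂ (A , p , min) | inj₁ ¬out =
  inj₂ (inside ∷ A , p , λ { (inside ∷ B) q → min B q ; (outside ∷ B) q → ⊥-elim (¬out B q) })
... | inj₁ ¬in | inj₂ (A , p , min) =
  inj₂ (outside ∷ A , p , λ { (inside ∷ B) q → ⊥-elim (¬in B q) ; (outside ∷ B) q → min B q })
... | inj₂ (A , p , minA) | inj₂ (A′ , p′ , minA′) with f (inside ∷ A) ℕ.≤? f (outside ∷ A′)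
...   | yes A≤A′ = inj₂ (inside ∷ A , p , λ { (inside ∷ B) q → minA B q
                                          ; (outside ∷ B) q → ℕP.≤-trans A≤A′ (minA′ B q) })
...   | no A≰A′ = inj₂ (outside ∷ A′ , p′ , λ { (inside ∷ B) q → ℕP.≤-trans (ℕP.<⇒≤ (ℕP.≰⇒> A≰A′)) (minA B q)
                                           ; (outside ∷ B) q → minA′ B q })

module _ {n} {G : Graph n} where

  walk-head : ∀ {E u v} → WalkIn G E u v → u ∈ E
  walk-head (stop u∈E) = u∈E
  walk-head (step u∈E _ _) = u∈E

  order≤hitting : ∀ {S : Scramble G} {m} → IsOrder S m → ∀ H → Hitting S H → m ≤ ∣ H ∣
  order≤hitting (h , (_ , min) , inj₁ (_ , refl)) H hits = min H hits
  order≤hitting (h , (_ , min) , inj₂ (e , _ , refl)) H hits = ℕP.≤-trans (ℕP.m⊓n≤m h e) (min H hits)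

  order≤separating : ∀ {S : Scramble G} {m} → IsOrder S m → ∀ A → Separating S A → m ≤ cutSize G A
  order≤separating (_ , _ , inj₁ (¬sep , _)) A sep = ⊥-elim (¬sep A sep)
  order≤separating (h , _ , inj₂ (e , (_ , min) , refl)) A sep = ℕP.≤-trans (ℕP.m⊓n≤n h e) (min A sep)

  egg⊆independent⇒⊆singleton : ∀ {I E} → Independent G I → IsEgg G E → E ⊆ I → ∃ λ v → v ∈ E × E ⊆ ⁅ v ⁆
  egg⊆independent⇒⊆singleton I-independent ((v , v∈E) , connected) E⊆I = v , v∈E , λ {x} x∈E →
    subst (_∈ ⁅ v ⁆) (sym (walk-trivial (connected v x v∈E x∈E))) (SubsetP.x∈⁅x⁆ v)
    where
    walk-trivial : ∀ {x} → WalkIn G _ v x → x ≡ v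
    walk-trivial (stop _) = refl
    walk-trivial (step v∈E vw walk) with () ← neighbour∉independent G I-independent (E⊆I v∈E) vw (E⊆I (walk-head walk))

module _ {n} (G : Graph n) (no-isolated : ∀ v → 1 ≤ val G v) {a} (α : IsIndependenceNumber G a) where
  private
    I = proj₁ (proj₁ α)
    I-independent = proj₁ (proj₂ (proj₁ α))
    ∣∁I∣≡n∸α = ∣∁maximumIndependent∣≡n∸α G α

  1≤n∸α : Fin n → 1 ≤ n ∸ a
  1≤n∸α v with 1≤val⇒neighbour G (no-isolated v)
  ... | u , vu with v SubsetP.∈? I
  ...   | yes v∈I =
    subst (1 ≤_) ∣∁I∣≡n∸α (x∈p⇒1≤∣p∣ (SubsetP.x∉p⇒x∈∁p (neighbour∉independent G I-independent v∈I vu)))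
  ...   | no v∉I = subst (1 ≤_) ∣∁I∣≡n∸α (x∈p⇒1≤∣p∣ (SubsetP.x∉p⇒x∈∁p v∉I))

  cutSize-singleton≤n∸α : ∀ {v} → v ∈ I → cutSize G ⁅ v ⁆ ≤ n ∸ a
  cutSize-singleton≤n∸α {v} v∈I = begin
    cutSize G ⁅ v ⁆                          ≡⟨ cutSize≡cut G ⁅ v ⁆ ⟩
    cut G (_∈ᵇ ⁅ v ⁆)                        ≤⟨ cut≤count*count G (_∈ᵇ ⁅ v ⁆) (_∈ᵇ ∁ I) exits-I ⟩
    count (_∈ᵇ ⁅ v ⁆) * count (_∈ᵇ ∁ I)      ≡⟨ cong₂ _*_ (∣p∣≡count-∈ᵇ ⁅ v ⁆) (∣p∣≡count-∈ᵇ (∁ I)) ⟨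
    ∣ ⁅ v ⁆ ∣ * ∣ ∁ I ∣                       ≡⟨ cong₂ _*_ (SubsetP.∣⁅x⁆∣≡1 v) ∣∁I∣≡n∸α ⟩
    1 * (n ∸ a)                              ≡⟨ ℕP.*-identityˡ (n ∸ a) ⟩
    n ∸ a                                    ∎
    where
    open ℕP.≤-Reasoning
    exits-I : ∀ {u w} → u ∈ᵇ ⁅ v ⁆ ≡ true → w ∈ᵇ ⁅ v ⁆ ≡ false → adj G u w ≡ true → w ∈ᵇ ∁ I ≡ true
    exits-I {u} {w} u∈v _ uw = dec-true (w SubsetP.∈? ∁ I) (SubsetP.x∉p⇒x∈∁p
      (neighbour∉independent G I-independent (subst (_∈ I) (sym (SubsetP.x∈⁅y⁆⇒x≡y v (∈ᵇ⇒∈ u∈v))) v∈I) uw))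

  order≤n∸α-if-egg⊆singleton : ∀ {S : Scramble G} {m} → IsOrder S m →
    ∀ {v E} → v ∈ I → E ∈ₗ eggs S → E ⊆ ⁅ v ⁆ → m ≤ n ∸ a
  order≤n∸α-if-egg⊆singleton {S} {m} o {v} {E} v∈I E∈S E⊆v with All.all? (v SubsetP.∈?_) (eggs S)
  ... | yes v∈all = ℕP.≤-trans (order≤hitting {S = S} o ⁅ v ⁆ (All.map (λ v∈E′ → v , SubsetP.x∈⁅x⁆ v , v∈E′) v∈all))
                      (subst (_≤ n ∸ a) (sym (SubsetP.∣⁅x⁆∣≡1 v)) (1≤n∸α v))
  ... | no ¬v∈all with E′ , E′∈S , v∉E′ ← ¬All⇒∃∈¬ (v SubsetP.∈?_) ¬v∈all =
    ℕP.≤-trans (order≤separating {S = S} o ⁅ v ⁆ ((E , E∈S , E⊆v) , (E′ , E′∈S , E′⊆∁v))) (cutSize-singleton≤n∸α v∈I)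
    where
    E′⊆∁v : E′ ⊆ ∁ ⁅ v ⁆
    E′⊆∁v {x} x∈E′ = SubsetP.x∉p⇒x∈∁p λ x∈v → v∉E′ (subst (_∈ E′) (SubsetP.x∈⁅y⁆⇒x≡y v x∈v) x∈E′)

  missing-∁I⇒⊆I : ∀ {E} → ¬ (∃ λ x → x ∈ ∁ I × x ∈ E) → E ⊆ I
  missing-∁I⇒⊆I E-misses-∁I {x} x∈E with x SubsetP.∈? I
  ... | yes x∈I = x∈I
  ... | no x∉I = ⊥-elim (E-misses-∁I (x , SubsetP.x∉p⇒x∈∁p x∉I , x∈E))

  order≤n∸α : ∀ (S : Scramble G) m → IsOrder S m → m ≤ n ∸ a
  order≤n∸α S m o with All.all? (λ E → FinP.any? λ x → x SubsetP.∈? ∁ I ×-dec x SubsetP.∈? E) (eggs S)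
  ... | yes ∁I-hits = subst (m ≤_) ∣∁I∣≡n∸α (order≤hitting {S = S} o (∁ I) ∁I-hits)
  ... | no ¬∁I-hits
    with E , E∈S , E-misses-∁I ← ¬All⇒∃∈¬ (λ E → FinP.any? λ x → x SubsetP.∈? ∁ I ×-dec x SubsetP.∈? E) ¬∁I-hits
    with v , v∈E , E⊆v ← egg⊆independent⇒⊆singleton I-independent (All.lookup (proj₂ S) E∈S) (missing-∁I⇒⊆I E-misses-∁I)
    = order≤n∸α-if-egg⊆singleton {S} o (missing-∁I⇒⊆I E-misses-∁I v∈E) E∈S E⊆v

-- The edge scramble

module _ {n} (G : Graph n) where

  edgeEgg : Fin n → Fin n → Subset n
  edgeEgg u v = ⁅ u ⁆ ∪ ⁅ v ⁆

  ∈edgeEggˡ : ∀ u v → u ∈ edgeEgg u v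
  ∈edgeEggˡ u v = SubsetP.x∈p∪q⁺ (inj₁ (SubsetP.x∈⁅x⁆ u))

  ∈edgeEggʳ : ∀ u v → v ∈ edgeEgg u v
  ∈edgeEggʳ u v = SubsetP.x∈p∪q⁺ (inj₂ (SubsetP.x∈⁅x⁆ v))

  ∈edgeEgg⁻ : ∀ {u v x} → x ∈ edgeEgg u v → x ≡ u ⊎ x ≡ v
  ∈edgeEgg⁻ {u} {v} x∈ with SubsetP.x∈p∪q⁻ ⁅ u ⁆ ⁅ v ⁆ x∈
  ... | inj₁ x∈u = inj₁ (SubsetP.x∈⁅y⁆⇒x≡y u x∈u)
  ... | inj₂ x∈v = inj₂ (SubsetP.x∈⁅y⁆⇒x≡y v x∈v)

  edgeEgg-isEgg : ∀ {u v} → adj G u v ≡ true → IsEgg G (edgeEgg u v)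
  edgeEgg-isEgg {u} {v} uv = (u , ∈edgeEggˡ u v) , connected
    where
    connected : InducesConnected G (edgeEgg u v)
    connected x y x∈ y∈ with ∈edgeEgg⁻ x∈ | ∈edgeEgg⁻ y∈
    ... | inj₁ refl | inj₁ refl = stop x∈
    ... | inj₂ refl | inj₂ refl = stop x∈
    ... | inj₁ refl | inj₂ refl = step x∈ uv (stop y∈)
    ... | inj₂ refl | inj₁ refl = step x∈ (trans (adj-sym G v u) uv) (stop y∈)

  isEdge? : (e : Fin n × Fin n) → Dec (adj G (proj₁ e) (proj₂ e) ≡ true)
  isEdge? (u , v) = adj G u v BoolP.≟ true

  edges : List (Fin n × Fin n)
  edges = List.filter isEdge? (List.cartesianProduct (List.allFin n) (List.allFin n))

  edgeEggs : List (Subset n)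
  edgeEggs = List.map (uncurry edgeEgg) edges

  edgeEgg∈edgeEggs : ∀ {u v} → adj G u v ≡ true → edgeEgg u v ∈ₗ edgeEggs
  edgeEgg∈edgeEggs {u} {v} uv =
    ∈ₗP.∈-map⁺ (uncurry edgeEgg)
      (∈ₗP.∈-filter⁺ isEdge? (∈ₗP.∈-cartesianProduct⁺ (∈ₗP.∈-allFin u) (∈ₗP.∈-allFin v)) uv)

  ∈edgeEggs⁻ : ∀ {E} → E ∈ₗ edgeEggs → ∃₂ λ u v → adj G u v ≡ true × E ≡ edgeEgg u v
  ∈edgeEggs⁻ E∈ with (u , v) , e∈ , refl ← ∈ₗP.∈-map⁻ (uncurry edgeEgg) E∈ =
    u , v , proj₂ (∈ₗP.∈-filter⁻ isEdge? {xs = List.cartesianProduct (List.allFin n) (List.allFin n)} e∈) , refl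

  edgeScramble : Scramble G
  edgeScramble = edgeEggs , All.tabulate λ E∈ → isEgg (∈edgeEggs⁻ E∈)
    where
    isEgg : ∀ {E} → (∃₂ λ u v → adj G u v ≡ true × E ≡ edgeEgg u v) → IsEgg G E
    isEgg (_ , _ , uv , refl) = edgeEgg-isEgg uv

module _ {n} (G : Graph n) (δ : ∀ v → n / 2 + 1 ≤ val G v) {a} (α : IsIndependenceNumber G a) where
  private
    I = proj₁ (proj₁ α)
    I-independent = proj₁ (proj₂ (proj₁ α))

  edgeScramble-hittingNumber : IsHittingNumber (edgeScramble G) (n ∸ a)
  edgeScramble-hittingNumber = (∁ I , All.tabulate ∁I-hits , ∣∁maximumIndependent∣≡n∸α G α) , n∸α≤hitting
    where
    ∁I-hits : ∀ {E} → E ∈ₗ edgeEggs G → ∃ λ x → x ∈ ∁ I × x ∈ E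
    ∁I-hits E∈ with u , v , uv , refl ← ∈edgeEggs⁻ G E∈ with u SubsetP.∈? I
    ... | no u∉I = u , SubsetP.x∉p⇒x∈∁p u∉I , ∈edgeEggˡ G u v
    ... | yes u∈I = v , SubsetP.x∉p⇒x∈∁p (neighbour∉independent G I-independent u∈I uv) , ∈edgeEggʳ G u v
    n∸α≤hitting : ∀ H → Hitting (edgeScramble G) H → n ∸ a ≤ ∣ H ∣
    n∸α≤hitting H hits = n∸α≤∣H∣ G α H ∁H-independent
      where
      ∁H-independent : Independent G (∁ H)
      ∁H-independent u v u∈∁H v∈∁H with adj G u v in uv
      ... | false = refl
      ... | true with x , x∈H , x∈uv ← All.lookup hits (edgeEgg∈edgeEggs G uv) with ∈edgeEgg⁻ G x∈uv
      ...   | inj₁ refl = ⊥-elim (SubsetP.x∈∁p⇒x∉p u∈∁H x∈H)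
      ...   | inj₂ refl = ⊥-elim (SubsetP.x∈∁p⇒x∉p v∈∁H x∈H)

  n∸α≤separating-cut : ∀ A → Separating (edgeScramble G) A → n ∸ a ≤ cutSize G A
  n∸α≤separating-cut A ((E , E∈ , E⊆A) , (E′ , E′∈ , E′⊆∁A))
    with u , v , uv , refl ← ∈edgeEggs⁻ G E∈ | u′ , v′ , u′v′ , refl ← ∈edgeEggs⁻ G E′∈ = begin
    n ∸ a                 ≤⟨ ℕP.∸-monoʳ-≤ n (1≤α G α u) ⟩
    n ∸ 1                 ≤⟨ n∸1≤cut G δ (_∈ᵇ A) 2≤∣A∣ 2≤∣∁A∣ ⟩
    cut G (_∈ᵇ A)         ≡⟨ cutSize≡cut G A ⟨
    cutSize G A           ∎
    where
    open ℕP.≤-Reasoning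
    in-A : ∀ {x} → x ∈ edgeEgg G u v → x ∈ᵇ A ≡ true
    in-A {x} x∈ = dec-true (x SubsetP.∈? A) (E⊆A x∈)
    out-A : ∀ {x} → x ∈ edgeEgg G u′ v′ → not (x ∈ᵇ A) ≡ true
    out-A {x} x∈ = cong not (dec-false (x SubsetP.∈? A) (SubsetP.x∈∁p⇒x∉p (E′⊆∁A x∈)))
    2≤∣A∣ : 2 ≤ count (_∈ᵇ A)
    2≤∣A∣ = 2≤count _ (adjacent⇒≢ G uv) (in-A (∈edgeEggˡ G u v)) (in-A (∈edgeEggʳ G u v))
    2≤∣∁A∣ : 2 ≤ count (not ∘ (_∈ᵇ A))
    2≤∣∁A∣ = 2≤count _ (adjacent⇒≢ G u′v′) (out-A (∈edgeEggˡ G u′ v′)) (out-A (∈edgeEggʳ G u′ v′))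

  separating? : ∀ A → Dec (Separating (edgeScramble G) A)
  separating? A = ∃∈? (SubsetP._⊆? A) (edgeEggs G) ×-dec ∃∈? (SubsetP._⊆? ∁ A) (edgeEggs G)

  edgeScramble-order : IsOrder (edgeScramble G) (n ∸ a)
  edgeScramble-order with minimal-subset (Separating (edgeScramble G)) separating? (cutSize G)
  ... | inj₁ ¬separating = n ∸ a , edgeScramble-hittingNumber , inj₁ (¬separating , refl)
  ... | inj₂ (A , A-separating , A-minimal) =
    n ∸ a , edgeScramble-hittingNumber ,
    inj₂ (cutSize G A , ((A , A-separating , refl) , A-minimal) , sym (ℕP.m≤n⇒m⊓n≡m (n∸α≤separating-cut A A-separating)))

-- Firing scripts

module _ {n} (G : Graph n) where

  adjℤ : Fin n → Fin n → ℤ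
  adjℤ v u = + bool→ℕ (adj G v u)

  -- the net number of chips v loses when every vertex u fires z u times
  laplacian : (Fin n → ℤ) → Divisor n
  laplacian z v = Σℤ λ u → adjℤ v u ℤ.* (z v ℤ.- z u)

  FiringScript : (Fin n → ℤ) → Divisor n → Divisor n → Set
  FiringScript z D D′ = ∀ v → D′ v ≡ D v ℤ.- laplacian z v

  laplacian-+ : ∀ z z′ v → laplacian (λ u → z u ℤ.+ z′ u) v ≡ laplacian z v ℤ.+ laplacian z′ v
  laplacian-+ z z′ v = trans (ℤΣ.sum-cong-≗ λ u → distrib (adjℤ v u) (z v) (z′ v) (z u) (z′ u))
                             (ℤΣ.∑-distrib-+ (λ u → adjℤ v u ℤ.* (z v ℤ.- z u)) (λ u → adjℤ v u ℤ.* (z′ v ℤ.- z′ u)))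
    where
    distrib : ∀ a x x′ y y′ → a ℤ.* ((x ℤ.+ x′) ℤ.- (y ℤ.+ y′)) ≡ a ℤ.* (x ℤ.- y) ℤ.+ a ℤ.* (x′ ℤ.- y′)
    distrib = solve-∀

  laplacian-neg : ∀ z v → laplacian (λ u → ℤ.- z u) v ≡ ℤ.- laplacian z v
  laplacian-neg z v = trans (ℤΣ.sum-cong-≗ λ u → distrib (adjℤ v u) (z v) (z u))
                            (Σℤ-neg (λ u → adjℤ v u ℤ.* (z v ℤ.- z u)))
    where
    distrib : ∀ a x y → a ℤ.* (ℤ.- x ℤ.- ℤ.- y) ≡ ℤ.- (a ℤ.* (x ℤ.- y))
    distrib = solve-∀

  laplacian-0 : ∀ v → laplacian (λ _ → + 0) v ≡ + 0
  laplacian-0 v = trans (ℤΣ.sum-cong-≗ λ u → ℤP.*-zeroʳ (adjℤ v u)) (ℤΣ.sum-replicate-zero n)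

  Σℤ-laplacian : ∀ z → Σℤ (laplacian z) ≡ + 0
  Σℤ-laplacian z = Σℤ-antisymmetric (λ v u → adjℤ v u ℤ.* (z v ℤ.- z u)) antisymmetric
    where
    antisymmetric : ∀ u v → adjℤ v u ℤ.* (z v ℤ.- z u) ≡ ℤ.- (adjℤ u v ℤ.* (z u ℤ.- z v))
    antisymmetric u v rewrite adj-sym G v u = flip (adjℤ u v) (z u) (z v)
      where
      flip : ∀ a x y → a ℤ.* (y ℤ.- x) ≡ ℤ.- (a ℤ.* (x ℤ.- y))
      flip = solve-∀

  fire≡laplacian-indicator : ∀ w D v → fire G w D v ≡ D v ℤ.- laplacian (λ u → + indicator w u) v
  fire≡laplacian-indicator w D v with v ≟ w
  ... | yes refl = cong (ℤ._-_ (D v)) (begin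
    + val G v                                ≡⟨ cong +_ (val≡Σℕ G v) ⟩
    + Σℕ (λ u → bool→ℕ (adj G v u))          ≡⟨ Σℤ-pos (λ u → bool→ℕ (adj G v u)) ⟨
    Σℤ (adjℤ v)                              ≡⟨ ℤΣ.sum-cong-≗ term ⟩
    Σℤ (λ u → adjℤ v u ℤ.* (+ 1 ℤ.- + indicator v u)) ∎)
    where
    open ≡-Reasoning
    term : ∀ u → adjℤ v u ≡ adjℤ v u ℤ.* (+ 1 ℤ.- + indicator v u)
    term u with u ≟ v
    ... | yes refl rewrite adj-irrefl G u = refl
    ... | no _ = sym (ℤP.*-identityʳ (adjℤ v u))
  ... | no _ = begin
    D v ℤ.+ + bool→ℕ (adj G w v)
      ≡⟨ cong (λ b → D v ℤ.+ + bool→ℕ b) (adj-sym G w v) ⟩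
    D v ℤ.+ adjℤ v w
      ≡⟨ cong (ℤ._+_ (D v)) (Σℤ-indicator w (adjℤ v)) ⟨
    D v ℤ.+ Σℤ (λ u → + indicator w u ℤ.* adjℤ v u)
      ≡⟨ cong (ℤ._+_ (D v)) (ℤP.neg-involutive _) ⟨
    D v ℤ.- ℤ.- Σℤ (λ u → + indicator w u ℤ.* adjℤ v u)
      ≡⟨ cong (ℤ._-_ (D v)) (Σℤ-neg (λ u → + indicator w u ℤ.* adjℤ v u)) ⟨
    D v ℤ.- Σℤ (λ u → ℤ.- (+ indicator w u ℤ.* adjℤ v u))
      ≡⟨ cong (ℤ._-_ (D v)) (ℤΣ.sum-cong-≗ λ u → term (+ indicator w u) (adjℤ v u)) ⟩
    D v ℤ.- Σℤ (λ u → adjℤ v u ℤ.* (+ 0 ℤ.- + indicator w u)) ∎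
    where
    open ≡-Reasoning
    term : ∀ i a → ℤ.- (i ℤ.* a) ≡ a ℤ.* (+ 0 ℤ.- i)
    term = solve-∀

  script-refl : ∀ D → FiringScript (λ _ → + 0) D D
  script-refl D v = sym (trans (cong (ℤ._-_ (D v)) (laplacian-0 v)) (ℤP.+-identityʳ (D v)))

  script-sym : ∀ {z D D′} → FiringScript z D D′ → FiringScript (λ u → ℤ.- z u) D′ D
  script-sym {z} {D} {D′} D→D′ v = begin
    D v                                      ≡⟨ cancel (D v) (laplacian z v) ⟨
    D v ℤ.- laplacian z v ℤ.- ℤ.- laplacian z v ≡⟨ cong₂ ℤ._-_ (D→D′ v) (laplacian-neg z v) ⟨
    D′ v ℤ.- laplacian (λ u → ℤ.- z u) v     ∎
    where
    open ≡-Reasoning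
    cancel : ∀ d l → d ℤ.- l ℤ.- ℤ.- l ≡ d
    cancel = solve-∀

  script-trans : ∀ {z z′ D D′ D″} → FiringScript z D D′ → FiringScript z′ D′ D″ →
    FiringScript (λ u → z u ℤ.+ z′ u) D D″
  script-trans {z} {z′} {D} {D′} {D″} D→D′ D′→D″ v = begin
    D″ v                                              ≡⟨ D′→D″ v ⟩
    D′ v ℤ.- laplacian z′ v                           ≡⟨ cong (ℤ._- laplacian z′ v) (D→D′ v) ⟩
    D v ℤ.- laplacian z v ℤ.- laplacian z′ v          ≡⟨ regroup (D v) (laplacian z v) (laplacian z′ v) ⟩
    D v ℤ.- (laplacian z v ℤ.+ laplacian z′ v)        ≡⟨ cong (ℤ._-_ (D v)) (laplacian-+ z z′ v) ⟨
    D v ℤ.- laplacian (λ u → z u ℤ.+ z′ u) v          ∎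
    where
    open ≡-Reasoning
    regroup : ∀ d l l′ → d ℤ.- l ℤ.- l′ ≡ d ℤ.- (l ℤ.+ l′)
    regroup = solve-∀

  firingStep⇒script : ∀ {D D′} → FiringStep G D D′ → ∃ λ z → FiringScript z D D′
  firingStep⇒script {D} (w , fired) = (λ u → + indicator w u) , λ v → trans (fired v) (fire≡laplacian-indicator w D v)

  ∼⇒script : ∀ {D D′} → D ∼[ G ] D′ → ∃ λ z → FiringScript z D D′
  ∼⇒script {D} ε = (λ _ → + 0) , script-refl D
  ∼⇒script {D} {D′} (_◅_ {j = M} (fwd move) rest)
    with z , D→M ← firingStep⇒script {D} {M} move | z′ , M→D′ ← ∼⇒script rest =
    (λ u → z u ℤ.+ z′ u) , script-trans {z} {z′} {D} {M} {D′} D→M M→D′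
  ∼⇒script {D} {D′} (_◅_ {j = M} (bwd move) rest)
    with z , M→D ← firingStep⇒script {M} {D} move | z′ , M→D′ ← ∼⇒script rest =
    (λ u → ℤ.- z u ℤ.+ z′ u) , script-trans {λ u → ℤ.- z u} {z′} {D} {M} {D′} (script-sym {z} {M} {D} M→D) M→D′

  script-deg : ∀ {z D D′} → FiringScript z D D′ → Σℤ D′ ≡ Σℤ D
  script-deg {z} {D} {D′} D→D′ = begin
    Σℤ D′                                        ≡⟨ ℤΣ.sum-cong-≗ D→D′ ⟩
    Σℤ (λ v → D v ℤ.- laplacian z v)             ≡⟨ ℤΣ.∑-distrib-+ D (λ v → ℤ.- laplacian z v) ⟩
    Σℤ D ℤ.+ Σℤ (λ v → ℤ.- laplacian z v)        ≡⟨ cong (ℤ._+_ (Σℤ D)) (Σℤ-neg (laplacian z)) ⟩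
    Σℤ D ℤ.- Σℤ (laplacian z)                    ≡⟨ cong (λ s → Σℤ D ℤ.- s) (Σℤ-laplacian z) ⟩
    Σℤ D ℤ.- + 0                                 ≡⟨ ℤP.+-identityʳ (Σℤ D) ⟩
    Σℤ D                                         ∎
    where open ≡-Reasoning

  minusPoint≡ : ∀ (D : Divisor n) v w → minusPoint D v w ≡ D w ℤ.- + indicator v w
  minusPoint≡ D v w with w ≟ v
  ... | yes _ = refl
  ... | no _ = sym (ℤP.+-identityʳ (D w))

  minusPoint-self : ∀ (D : Divisor n) v → minusPoint D v v ≡ D v ℤ.- + 1
  minusPoint-self D v = trans (minusPoint≡ D v v) (cong (λ i → D v ℤ.- + i) (indicator-self v))

  minusPoint-other : ∀ (D : Divisor n) {v w} → w ≢ v → minusPoint D v w ≡ D w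
  minusPoint-other D {v} {w} w≢v =
    trans (minusPoint≡ D v w) (trans (cong (λ i → D w ℤ.- + i) (indicator-other w≢v)) (ℤP.+-identityʳ (D w)))

  minusPoint≤ : ∀ (D : Divisor n) v w → minusPoint D v w ℤ.≤ D w
  minusPoint≤ D v w = subst (ℤ._≤ D w) (sym (minusPoint≡ D v w)) (ℤP.i-j≤i (D w) (+ indicator v w))

  PositiveRankByScripts : Divisor n → Set
  PositiveRankByScripts D = ∀ v → ∃ λ z → ∀ w → laplacian z w ℤ.≤ minusPoint D v w

  positiveRank⇒byScripts : ∀ {D} → PositiveRank G D → PositiveRankByScripts D
  positiveRank⇒byScripts {D} positive v with E , D-v∼E , E≥0 ← positive v with z , D-v→E ← ∼⇒script D-v∼E =
    z , λ w → ℤP.0≤i-j⇒j≤i (subst (+ 0 ℤ.≤_) (D-v→E w) (E≥0 w))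

  byScripts-transfer : ∀ {z D D′} → FiringScript z D D′ → PositiveRankByScripts D → PositiveRankByScripts D′
  byScripts-transfer {z} {D} {D′} D→D′ positive v with zᵥ , zᵥ-bound ← positive v =
    (λ u → zᵥ u ℤ.- z u) , λ w → begin
      laplacian (λ u → zᵥ u ℤ.- z u) w                   ≡⟨ laplacian-+ zᵥ (λ u → ℤ.- z u) w ⟩
      laplacian zᵥ w ℤ.+ laplacian (λ u → ℤ.- z u) w     ≡⟨ cong (ℤ._+_ (laplacian zᵥ w)) (laplacian-neg z w) ⟩
      laplacian zᵥ w ℤ.- laplacian z w                   ≤⟨ ℤP.+-monoˡ-≤ (ℤ.- laplacian z w) (zᵥ-bound w) ⟩
      minusPoint D v w ℤ.- laplacian z w                 ≡⟨ shift w ⟩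
      minusPoint D′ v w                                  ∎
    where
    open ℤP.≤-Reasoning
    shift : ∀ w → minusPoint D v w ℤ.- laplacian z w ≡ minusPoint D′ v w
    shift w = begin-equality
      minusPoint D v w ℤ.- laplacian z w                       ≡⟨ cong (ℤ._- laplacian z w) (minusPoint≡ D v w) ⟩
      D w ℤ.- + indicator v w ℤ.- laplacian z w               ≡⟨ swap (D w) (+ indicator v w) (laplacian z w) ⟩
      D w ℤ.- laplacian z w ℤ.- + indicator v w               ≡⟨ cong (ℤ._- + indicator v w) (D→D′ w) ⟨
      D′ w ℤ.- + indicator v w                                ≡⟨ minusPoint≡ D′ v w ⟨
      minusPoint D′ v w                                       ∎
      where
      swap : ∀ d i l → d ℤ.- i ℤ.- l ≡ d ℤ.- l ℤ.- i
      swap = solve-∀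

  -- adding back the removed chip to an effective divisor equivalent to D − (v₀)
  effective-representative : ∀ {D} → PositiveRank G D → Fin n →
    ∃₂ λ (c : Fin n → ℕ) z → FiringScript z D (λ u → + c u)
  effective-representative {D} positive v₀ with E , D-v₀∼E , E≥0 ← positive v₀ with z , D-v₀→E ← ∼⇒script D-v₀∼E =
    (λ u → ℤ.∣ E u ∣ + indicator v₀ u) , z , λ w → begin
      + (ℤ.∣ E w ∣ + indicator v₀ w)
        ≡⟨ ℤP.pos-+ ℤ.∣ E w ∣ (indicator v₀ w) ⟩
      + ℤ.∣ E w ∣ ℤ.+ + indicator v₀ w
        ≡⟨ cong (ℤ._+ + indicator v₀ w) (ℤP.0≤i⇒+∣i∣≡i (E≥0 w)) ⟩
      E w ℤ.+ + indicator v₀ w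
        ≡⟨ cong (ℤ._+ + indicator v₀ w) (D-v₀→E w) ⟩
      minusPoint D v₀ w ℤ.- laplacian z w ℤ.+ + indicator v₀ w
        ≡⟨ cong (λ x → x ℤ.- laplacian z w ℤ.+ + indicator v₀ w) (minusPoint≡ D v₀ w) ⟩
      D w ℤ.- + indicator v₀ w ℤ.- laplacian z w ℤ.+ + indicator v₀ w
        ≡⟨ cancel (D w) (+ indicator v₀ w) (laplacian z w) ⟩
      D w ℤ.- laplacian z w ∎
    where
    open ≡-Reasoning
    cancel : ∀ d i l → d ℤ.- i ℤ.- l ℤ.+ i ≡ d ℤ.- l
    cancel = solve-∀

  lowerNeighbours : (Fin n → ℤ) → Fin n → ℕ
  lowerNeighbours z w = Σℕ λ x → bool→ℕ (adj G w x ∧ does (z x ℤP.<? z w))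

  localMax⇒lowerNeighbours≤laplacian : ∀ z w → (∀ x → adj G w x ≡ true → z x ℤ.≤ z w) →
    + lowerNeighbours z w ℤ.≤ laplacian z w
  localMax⇒lowerNeighbours≤laplacian z w localMax = begin
    + lowerNeighbours z w                                    ≡⟨ Σℤ-pos (λ x → bool→ℕ (adj G w x ∧ does (z x ℤP.<? z w))) ⟨
    Σℤ (λ x → + bool→ℕ (adj G w x ∧ does (z x ℤP.<? z w)))   ≤⟨ Σℤ-mono-≤ term ⟩
    laplacian z w                                            ∎
    where
    open ℤP.≤-Reasoning
    term : ∀ x → + bool→ℕ (adj G w x ∧ does (z x ℤP.<? z w)) ℤ.≤ adjℤ w x ℤ.* (z w ℤ.- z x)
    term x with adj G w x in wx | z x ℤP.<? z w
    ... | false | _ = ℤP.≤-refl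
    ... | true | yes x<w = subst (+ 1 ℤ.≤_) (sym (ℤP.*-identityˡ _)) (i<j⇒1≤j-i x<w)
    ... | true | no _ = subst (+ 0 ℤ.≤_) (sym (ℤP.*-identityˡ _)) (ℤP.i≤j⇒0≤j-i (localMax x wx))

  localMax⇒0≤laplacian : ∀ z w → (∀ x → adj G w x ≡ true → z x ℤ.≤ z w) → + 0 ℤ.≤ laplacian z w
  localMax⇒0≤laplacian z w localMax = ℤP.≤-trans (ℤ.+≤+ z≤n) (localMax⇒lowerNeighbours≤laplacian z w localMax)

  localMax⇒1≤laplacian : ∀ z w {y} → (∀ x → adj G w x ≡ true → z x ℤ.≤ z w) →
    adj G w y ≡ true → z y ℤ.< z w → + 1 ℤ.≤ laplacian z w
  localMax⇒1≤laplacian z w {y} localMax wy y<w = ℤP.≤-trans (ℤ.+≤+ 1≤lower) (localMax⇒lowerNeighbours≤laplacian z w localMax)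
    where
    1≤lower : 1 ≤ lowerNeighbours z w
    1≤lower = subst (_≤ lowerNeighbours z w) (cong₂ (λ b b′ → bool→ℕ (b ∧ b′)) wy (dec-true (z y ℤP.<? z w) y<w))
                (term≤Σℕ (λ x → bool→ℕ (adj G w x ∧ does (z x ℤP.<? z w))) y)

  strictLocalMax⇒val≤laplacian : ∀ z w → (∀ x → adj G w x ≡ true → z x ℤ.< z w) → + val G w ℤ.≤ laplacian z w
  strictLocalMax⇒val≤laplacian z w strictMax = subst (ℤ._≤ laplacian z w) (cong +_ val≡lower)
    (localMax⇒lowerNeighbours≤laplacian z w (λ x wx → ℤP.<⇒≤ (strictMax x wx)))
    where
    val≡lower : lowerNeighbours z w ≡ val G w
    val≡lower = trans (ℕΣ.sum-cong-≗ term) (sym (val≡Σℕ G w))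
      where
      term : ∀ x → bool→ℕ (adj G w x ∧ does (z x ℤP.<? z w)) ≡ bool→ℕ (adj G w x)
      term x with adj G w x in wx
      ... | false = refl
      ... | true = cong bool→ℕ (dec-true (z x ℤP.<? z w) (strictMax x wx))

  cut-upperSet≤Σ-laplacian : ∀ z S → (∀ w x → S w ≡ true → S x ≡ false → z x ℤ.< z w) →
    + cut G S ℤ.≤ Σℤ (λ w → + bool→ℕ (S w) ℤ.* laplacian z w)
  cut-upperSet≤Σ-laplacian z S upper = begin
    + cut G S
      ≡⟨ cut-as-Σℤ ⟩
    Σℤ (λ w → Σℤ (leaving w))
      ≡⟨ ℤP.+-identityˡ _ ⟨
    + 0 ℤ.+ Σℤ (λ w → Σℤ (leaving w))
      ≡⟨ cong (ℤ._+ Σℤ (λ w → Σℤ (leaving w))) (Σℤ-antisymmetric internal internal-antisymmetric) ⟨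
    Σℤ (λ w → Σℤ (internal w)) ℤ.+ Σℤ (λ w → Σℤ (leaving w))
      ≡⟨ double-distrib ⟨
    Σℤ (λ w → Σℤ (λ x → internal w x ℤ.+ leaving w x))
      ≤⟨ Σℤ-mono-≤ (λ w → Σℤ-mono-≤ (pointwise w)) ⟩
    Σℤ (λ w → Σℤ (λ x → s w ℤ.* flow w x))
      ≡⟨ ℤΣ.sum-cong-≗ (λ w → ℤΣ.*-distribˡ-sum (s w) (flow w)) ⟨
    Σℤ (λ w → s w ℤ.* laplacian z w) ∎
    where
    open ℤP.≤-Reasoning
    s : Fin n → ℤ
    s w = + bool→ℕ (S w)
    flow : Fin n → Fin n → ℤ
    flow w x = adjℤ w x ℤ.* (z w ℤ.- z x)
    internal : Fin n → Fin n → ℤ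
    internal w x = s w ℤ.* (s x ℤ.* flow w x)
    leaving : Fin n → Fin n → ℤ
    leaving w x = + bool→ℕ (S w ∧ not (S x) ∧ adj G w x)

    cut-as-Σℤ : + cut G S ≡ Σℤ (λ w → Σℤ (leaving w))
    cut-as-Σℤ = sym (trans (ℤΣ.sum-cong-≗ λ w → Σℤ-pos (λ x → bool→ℕ (S w ∧ not (S x) ∧ adj G w x)))
                           (Σℤ-pos (λ w → Σℕ λ x → bool→ℕ (S w ∧ not (S x) ∧ adj G w x))))

    internal-antisymmetric : ∀ w x → internal x w ≡ ℤ.- internal w x
    internal-antisymmetric w x rewrite adj-sym G x w = flip (s w) (s x) (adjℤ w x) (z w) (z x)
      where
      flip : ∀ p q a y y′ → q ℤ.* (p ℤ.* (a ℤ.* (y′ ℤ.- y))) ≡ ℤ.- (p ℤ.* (q ℤ.* (a ℤ.* (y ℤ.- y′))))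
      flip = solve-∀

    double-distrib : Σℤ (λ w → Σℤ (λ x → internal w x ℤ.+ leaving w x))
                   ≡ Σℤ (λ w → Σℤ (internal w)) ℤ.+ Σℤ (λ w → Σℤ (leaving w))
    double-distrib = trans (ℤΣ.sum-cong-≗ λ w → ℤΣ.∑-distrib-+ (internal w) (leaving w))
                           (ℤΣ.∑-distrib-+ (λ w → Σℤ (internal w)) (λ w → Σℤ (leaving w)))

    pointwise : ∀ w x → internal w x ℤ.+ leaving w x ℤ.≤ s w ℤ.* flow w x
    pointwise w x with S w in Sw | S x in Sx | adj G w x
    ... | false | _     | _     = ℤP.≤-refl
    ... | true  | true  | true  = ℤP.≤-reflexive (trans (ℤP.+-identityʳ _) (ℤP.*-identityˡ _))
    ... | true  | true  | false = ℤP.≤-refl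
    ... | true  | false | false = ℤP.≤-refl
    ... | true  | false | true  = subst₂ ℤ._≤_ (sym (ℤP.+-identityˡ (+ 1))) (sym (ℤP.*-identityˡ _))
                                    (subst (+ 1 ℤ.≤_) (sym (ℤP.*-identityˡ _)) (i<j⇒1≤j-i (upper w x Sw Sx)))

  upperSet-cut≤chips : ∀ (c : Fin n → ℕ) z S → (∀ w → laplacian z w ℤ.≤ + c w) →
    (∀ w x → S w ≡ true → S x ≡ false → z x ℤ.< z w) → cut G S ≤ Σℕ c
  upperSet-cut≤chips c z S laplacian≤c upper = ℤP.drop‿+≤+ (begin
    + cut G S                                        ≤⟨ cut-upperSet≤Σ-laplacian z S upper ⟩
    Σℤ (λ w → + bool→ℕ (S w) ℤ.* laplacian z w)       ≤⟨ Σℤ-mono-≤ term ⟩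
    Σℤ (λ w → + c w)                                 ≡⟨ Σℤ-pos c ⟩
    + Σℕ c                                           ∎)
    where
    open ℤP.≤-Reasoning
    term : ∀ w → + bool→ℕ (S w) ℤ.* laplacian z w ℤ.≤ + c w
    term w with S w
    ... | false = ℤ.+≤+ z≤n
    ... | true = subst (ℤ._≤ + c w) (sym (ℤP.*-identityˡ _)) (laplacian≤c w)

module _ {n} (G : Graph n) (c : Fin n → ℕ) where

  heavy : Fin n → Bool
  heavy w = does (val G w ℕ.≤? c w)

  hasHeavyNeighbour? : ∀ w → Dec (∃ λ x → heavy x ≡ true × adj G w x ≡ true)
  hasHeavyNeighbour? w = FinP.any? λ x → (heavy x BoolP.≟ true) ×-dec (adj G w x BoolP.≟ true)

  good : Fin n → Bool
  good w = does (c w ℕ.≟ 0) ∧ not (does (hasHeavyNeighbour? w))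

  heavy⇒val≤chips : ∀ {w} → heavy w ≡ true → val G w ≤ c w
  heavy⇒val≤chips = true⇒witness (_ ℕ.≤? _)

  good⇒chipless : ∀ {w} → good w ≡ true → c w ≡ 0
  good⇒chipless {w} good-w with c w | good-w
  ... | zero | _ = refl

  good⇒no-heavy-neighbour : ∀ {w x} → good w ≡ true → heavy x ≡ true → adj G w x ≡ true → ⊥
  good⇒no-heavy-neighbour {w} {x} good-w heavy-x wx with c w | hasHeavyNeighbour? w | good-w
  ... | zero | no ∄heavy | _ = ∄heavy (x , heavy-x , wx)

  -- heavy vertices pay for their neighbours, every other vertex that is not good pays for itself
  count-not-good-nor-heavy≤Σchips : count (λ w → not (good w ∨ heavy w)) ≤ Σℕ c
  count-not-good-nor-heavy≤Σchips = begin
    count (λ w → not (good w ∨ heavy w))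
      ≤⟨ Σℕ-mono-≤ charge ⟩
    Σℕ (λ w → light w + bool→ℕ (does (hasHeavyNeighbour? w)))
      ≡⟨ ℕΣ.∑-distrib-+ light (λ w → bool→ℕ (does (hasHeavyNeighbour? w))) ⟩
    Σℕ light + Σℕ (λ w → bool→ℕ (does (hasHeavyNeighbour? w)))
      ≤⟨ ℕP.+-monoʳ-≤ (Σℕ light) (Σℕ-mono-≤ hasHeavyNeighbour≤) ⟩
    Σℕ light + Σℕ (λ w → Σℕ λ x → heavyNeighbour w x)
      ≡⟨ cong (_+_ (Σℕ light)) (ℕΣ.∑-comm heavyNeighbour) ⟩
    Σℕ light + Σℕ (λ x → Σℕ λ w → heavyNeighbour w x)
      ≤⟨ ℕP.+-monoʳ-≤ (Σℕ light) (Σℕ-mono-≤ neighboursOfHeavy≤) ⟩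
    Σℕ light + Σℕ heavyChips
      ≡⟨ ℕΣ.∑-distrib-+ light heavyChips ⟨
    Σℕ (λ w → light w + heavyChips w)
      ≡⟨ ℕΣ.sum-cong-≗ split ⟩
    Σℕ c ∎
    where
    open ℕP.≤-Reasoning
    light heavyChips : Fin n → ℕ
    light w = if heavy w then 0 else c w
    heavyChips w = if heavy w then c w else 0
    heavyNeighbour : Fin n → Fin n → ℕ
    heavyNeighbour w x = bool→ℕ (heavy x ∧ adj G w x)

    charge : ∀ w → bool→ℕ (not (good w ∨ heavy w)) ≤ light w + bool→ℕ (does (hasHeavyNeighbour? w))
    charge w = chargeᵇ (heavy w) (does (hasHeavyNeighbour? w)) (c w)
      where
      chargeᵇ : ∀ h k m → bool→ℕ (not (((m ℕ.≡ᵇ 0) ∧ not k) ∨ h)) ≤ (if h then 0 else m) + bool→ℕ k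
      chargeᵇ true  true  zero    = z≤n
      chargeᵇ true  false zero    = z≤n
      chargeᵇ true  _     (suc m) = z≤n
      chargeᵇ false true  zero    = ℕP.≤-refl
      chargeᵇ false false zero    = z≤n
      chargeᵇ false _     (suc m) = s≤s z≤n

    hasHeavyNeighbour≤ : ∀ w → bool→ℕ (does (hasHeavyNeighbour? w)) ≤ Σℕ (heavyNeighbour w)
    hasHeavyNeighbour≤ w with hasHeavyNeighbour? w
    ... | no _ = z≤n
    ... | yes (x , heavy-x , wx) = subst (_≤ Σℕ (heavyNeighbour w)) (cong₂ (λ b b′ → bool→ℕ (b ∧ b′)) heavy-x wx)
                                     (term≤Σℕ (heavyNeighbour w) x)

    neighboursOfHeavy≤ : ∀ x → Σℕ (λ w → heavyNeighbour w x) ≤ heavyChips x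
    neighboursOfHeavy≤ x with heavy x in heavy-x
    ... | false = ℕP.≤-reflexive (ℕΣ.sum-replicate-zero n)
    ... | true = ℕP.≤-trans (ℕP.≤-reflexive (trans (ℕΣ.sum-cong-≗ λ w → cong bool→ℕ (adj-sym G w x)) (sym (val≡Σℕ G x))))
                   (heavy⇒val≤chips heavy-x)

    split : ∀ w → light w + heavyChips w ≡ c w
    split w with heavy w
    ... | true = refl
    ... | false = ℕP.+-identityʳ (c w)

  strictLocalMax⇒heavy : ∀ z → (∀ w → laplacian G z w ℤ.≤ + c w) →
    ∀ u → (∀ x → adj G u x ≡ true → z x ℤ.< z u) → heavy u ≡ true
  strictLocalMax⇒heavy z laplacian≤c u strictMax =
    dec-true (val G u ℕ.≤? c u) (ℤP.drop‿+≤+ (ℤP.≤-trans (strictLocalMax⇒val≤laplacian G z u strictMax) (laplacian≤c u)))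

-- Divisors of degree below n − α do not have positive rank

module _ {n} (G : Graph n) (δ : ∀ v → n / 2 + 1 ≤ val G v) {a} (α : IsIndependenceNumber G a)
         (c : Fin n → ℕ) (positive : PositiveRankByScripts G (λ u → + c u)) (few : Σℕ c < n ∸ a) where

  private
    HasHigherNeighbour : (Fin n → ℤ) → Fin n → Set
    HasHigherNeighbour z w = ∃ λ x → adj G w x ≡ true × z w ℤ.< z x

    hasHigherNeighbour? : ∀ z w → Dec (HasHigherNeighbour z w)
    hasHigherNeighbour? z w = FinP.any? λ x → (adj G w x BoolP.≟ true) ×-dec (z w ℤP.<? z x)

    ¬higher⇒localMax : ∀ {z w} → ¬ HasHigherNeighbour z w → ∀ x → adj G w x ≡ true → z x ℤ.≤ z w
    ¬higher⇒localMax ∄higher x wx = ℤP.≮⇒≥ λ w<x → ∄higher (x , wx , w<x)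

    a<n : a < n
    a<n = ℕP.m∸n≢0⇒n<m (ℕP.n>0⇒n≢0 (ℕP.≤-<-trans z≤n few))

    chips<n∸1 : Σℕ c < n ∸ 1
    chips<n∸1 = ℕP.<-≤-trans few (ℕP.∸-monoʳ-≤ n (1≤α G α (Fin.fromℕ< (ℕP.≤-<-trans z≤n a<n))))

    ChipBounded : (Fin n → ℤ) → Set
    ChipBounded z = ∀ w → laplacian G z w ℤ.≤ + c w

    no-balanced-upperSet : ∀ z → ChipBounded z → ∀ S → (∀ w x → S w ≡ true → S x ≡ false → z x ℤ.< z w) →
      2 ≤ count S → 2 ≤ count (not ∘ S) → ⊥
    no-balanced-upperSet z bounded S upper 2≤∣S∣ 2≤∣∁S∣ =
      ℕP.<⇒≱ chips<n∸1 (ℕP.≤-trans (n∸1≤cut G δ S 2≤∣S∣ 2≤∣∁S∣) (upperSet-cut≤chips G c z S bounded upper))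

    above : (Fin n → ℤ) → Fin n → Fin n → Bool
    above z g x = does (z g ℤP.<? z x)

    above-upper : ∀ z g w x → above z g w ≡ true → above z g x ≡ false → z x ℤ.< z w
    above-upper z g w x g<w g≮x =
      ℤP.≤-<-trans (ℤP.≮⇒≥ (false⇒¬witness (z g ℤP.<? z x) g≮x)) (true⇒witness (z g ℤP.<? z w) g<w)

    -- If some w ≠ g were not above g, the vertices above g would form an upper set with two vertices
    -- on each side, unless u is alone up there; but then u is a strict local maximum, hence heavy.
    good-below-neighbour⇒minimum : ∀ z → ChipBounded z → ∀ {g u} → good G c g ≡ true → adj G g u ≡ true →
      z g ℤ.< z u → ∀ w → w ≢ g → z g ℤ.< z w
    good-below-neighbour⇒minimum z bounded {g} {u} good-g gu g<u w w≢g with z g ℤP.<? z w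
    ... | yes g<w = g<w
    ... | no g≮w with FinP.any? (λ x → Dec.¬? (x ≟ u) ×-dec (z g ℤP.<? z x))
    ...   | yes (x , x≢u , g<x) = ⊥-elim (no-balanced-upperSet z bounded (above z g) (above-upper z g)
              (2≤count (above z g) (x≢u ∘ sym) (dec-true (z g ℤP.<? z u) g<u) (dec-true (z g ℤP.<? z x) g<x))
              (2≤count (not ∘ above z g) (w≢g ∘ sym) (cong not (dec-false (z g ℤP.<? z g) (ℤP.<-irrefl refl)))
                                                     (cong not (dec-false (z g ℤP.<? z w) g≮w))))
    ...   | no ∄x = ⊥-elim (good⇒no-heavy-neighbour G c good-g (strictLocalMax⇒heavy G c z bounded u strictMax) gu)
      where
      strictMax : ∀ x → adj G u x ≡ true → z x ℤ.< z u
      strictMax x ux = ℤP.≤-<-trans (ℤP.≮⇒≥ λ g<x → ∄x (x , (λ x≡u → adjacent⇒≢ G ux (sym x≡u)) , g<x)) g<u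

    -- In the script moving a chip onto v₁, both good vertices need a higher neighbour.
    module GoodPair {v₁ v₂} (good₁ : good G c v₁ ≡ true) (good₂ : good G c v₂ ≡ true) (v₁v₂ : adj G v₁ v₂ ≡ true) where
      z = proj₁ (positive v₁)

      v₂≢v₁ : v₂ ≢ v₁
      v₂≢v₁ = adjacent⇒≢ G v₁v₂ ∘ sym

      bounded : ChipBounded z
      bounded w = ℤP.≤-trans (proj₂ (positive v₁) w) (minusPoint≤ G (λ u → + c u) v₁ w)

      at-v₁ : laplacian G z v₁ ℤ.≤ -[1+ 0 ]
      at-v₁ = subst (laplacian G z v₁ ℤ.≤_)
        (trans (minusPoint-self G (λ u → + c u) v₁) (cong (λ i → + i ℤ.- + 1) (good⇒chipless G c good₁)))
        (proj₂ (positive v₁) v₁)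

      at-v₂ : laplacian G z v₂ ℤ.≤ + 0
      at-v₂ = subst (laplacian G z v₂ ℤ.≤_)
        (trans (minusPoint-other G (λ u → + c u) v₂≢v₁) (cong +_ (good⇒chipless G c good₂)))
        (proj₂ (positive v₁) v₂)

      v₁-has-higher : HasHigherNeighbour z v₁
      v₁-has-higher with hasHigherNeighbour? z v₁
      ... | yes higher = higher
      ... | no ∄higher = ⊥-elim (ℤP.<⇒≱ (ℤP.≤-<-trans at-v₁ ℤ.-<+)
              (localMax⇒0≤laplacian G z v₁ (¬higher⇒localMax ∄higher)))

      v₁<v₂ : z v₁ ℤ.< z v₂
      v₁<v₂ with u₁ , v₁u₁ , v₁<u₁ ← v₁-has-higher =
        good-below-neighbour⇒minimum z bounded good₁ v₁u₁ v₁<u₁ v₂ v₂≢v₁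

      v₂-has-higher : HasHigherNeighbour z v₂
      v₂-has-higher with hasHigherNeighbour? z v₂
      ... | yes higher = higher
      ... | no ∄higher = ⊥-elim (ℤP.<⇒≱ (ℤP.≤-<-trans at-v₂ (ℤ.+<+ (s≤s z≤n)))
              (localMax⇒1≤laplacian G z v₂ (¬higher⇒localMax ∄higher) (trans (adj-sym G v₂ v₁) v₁v₂) v₁<v₂))

      v₂<v₁ : z v₂ ℤ.< z v₁
      v₂<v₁ with u₂ , v₂u₂ , v₂<u₂ ← v₂-has-higher =
        good-below-neighbour⇒minimum z bounded good₂ v₂u₂ v₂<u₂ v₁ (adjacent⇒≢ G v₁v₂)

    good-or-heavy : Fin n → Bool
    good-or-heavy w = good G c w ∨ heavy G c w

    α<count-good-or-heavy : a < count good-or-heavy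
    α<count-good-or-heavy = ℕP.≰⇒> λ count≤α → ℕP.<⇒≱ few (begin
      n ∸ a                                        ≤⟨ ℕP.m≤n+o⇒m∸n≤o n a (begin
        n                                                ≡⟨ count+count-not good-or-heavy ⟨
        count good-or-heavy + count (not ∘ good-or-heavy) ≤⟨ ℕP.+-monoˡ-≤ _ count≤α ⟩
        a + count (not ∘ good-or-heavy)                  ∎) ⟩
      count (not ∘ good-or-heavy)                  ≤⟨ count-not-good-nor-heavy≤Σchips G c ⟩
      Σℕ c                                         ∎)
      where open ℕP.≤-Reasoning

    heavy-pair⇒⊥ : ∀ {u v} → heavy G c u ≡ true → heavy G c v ≡ true → u ≢ v → ⊥
    heavy-pair⇒⊥ {u} {v} heavy-u heavy-v u≢v = ℕP.<-irrefl refl (begin-strict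
      n                   <⟨ n<val+val G δ u v ⟩
      val G u + val G v   ≤⟨ ℕP.+-mono-≤ (heavy⇒val≤chips G c heavy-u) (heavy⇒val≤chips G c heavy-v) ⟩
      c u + c v           ≤⟨ two-terms≤Σℕ c u≢v ⟩
      Σℕ c                <⟨ few ⟩
      n ∸ a               ≤⟨ ℕP.m∸n≤m n a ⟩
      n                   ∎)
      where open ℕP.≤-Reasoning

  few-chips⇒⊥ : ⊥
  few-chips⇒⊥ with u , v , u-ok , v-ok , uv ← count>α⇒edge G α good-or-heavy α<count-good-or-heavy
    with ∨≡true⇒⊎ {good G c u} u-ok | ∨≡true⇒⊎ {good G c v} v-ok
  ... | inj₁ good-u | inj₁ good-v = let open GoodPair good-u good-v uv in ℤP.<-asym v₁<v₂ v₂<v₁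
  ... | inj₁ good-u | inj₂ heavy-v = good⇒no-heavy-neighbour G c good-u heavy-v uv
  ... | inj₂ heavy-u | inj₁ good-v = good⇒no-heavy-neighbour G c good-v heavy-u (trans (adj-sym G v u) uv)
  ... | inj₂ heavy-u | inj₂ heavy-v = heavy-pair⇒⊥ heavy-u heavy-v (adjacent⇒≢ G uv)

n∸α≤chips : ∀ {n} (G : Graph n) → (∀ v → n / 2 + 1 ≤ val G v) → ∀ {a} → IsIndependenceNumber G a →
  ∀ (c : Fin n → ℕ) → PositiveRankByScripts G (λ u → + c u) → n ∸ a ≤ Σℕ c
n∸α≤chips {n} G δ {a} α c positive with n ∸ a ℕ.≤? Σℕ c
... | yes enough = enough
... | no ¬enough = ⊥-elim (few-chips⇒⊥ G δ α c positive (ℕP.≰⇒> ¬enough))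

n∸α≤deg : ∀ {n} (G : Graph n) → (∀ v → n / 2 + 1 ≤ val G v) → ∀ {a} → IsIndependenceNumber G a →
  ∀ D → PositiveRank G D → + (n ∸ a) ℤ.≤ deg D
n∸α≤deg {zero} G δ {a} α D positive rewrite ℕP.0∸n≡0 a = ℤP.≤-refl
n∸α≤deg {suc n} G δ {a} α D positive with c , z , D→c ← effective-representative G positive zero = begin
  + (suc n ∸ a)            ≤⟨ ℤ.+≤+ (n∸α≤chips G δ α c c-positive) ⟩
  + Σℕ c                   ≡⟨ Σℤ-pos c ⟨
  Σℤ (λ u → + c u)         ≡⟨ script-deg G {z} {D} D→c ⟩
  Σℤ D                     ≡⟨ sumℤ≡Σℤ D ⟨
  deg D                    ∎
  where
  open ℤP.≤-Reasoning
  c-positive : PositiveRankByScripts G (λ u → + c u)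
  c-positive = byScripts-transfer G {z} {D} D→c (positiveRank⇒byScripts G positive)

corollary3p2 : (n : ℕ) (G : Graph n) →
    (∀ (v : Fin n) → n / 2 + 1 ≤ val G v) →
    (a : ℕ) → IsIndependenceNumber G a →
    IsScrambleNumber G (n ∸ a) × IsGonality G (n ∸ a)
corollary3p2 n G δ a α@((I , I-independent , ∣I∣≡a) , _) =
  ((edgeScramble G , edgeScramble-order G δ α) , order≤n∸α G no-isolated α) ,
  ((outsideDivisor G I , outsideDivisor-positiveRank G I I-independent no-isolated , deg≡n∸α) , n∸α≤deg G δ α)
  where
  no-isolated : ∀ v → 1 ≤ val G v
  no-isolated v = ℕP.≤-trans (ℕP.m≤n+m 1 (n / 2)) (δ v)
  deg≡n∸α : deg (outsideDivisor G I) ≡ + (n ∸ a)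
  deg≡n∸α = trans (deg-outsideDivisor G I) (cong (λ k → + (n ∸ k)) ∣I∣≡a)
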